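{- For every $n\ge1$ and $\mathbf s\in\mathbb N^n$, the map $\alpha\mapsto\mathcal T_\vee(\alpha)$ is a bijection from the set of $\mathbf s$-arcs to the set of join irreducible elements of the $\mathbf s$-weak order, and the map $\alpha\mapsto\mathcal T_\wedge(\alpha)$ is a bijection from the set of $\mathbf s$-arcs to the set of meet irreducible elements of the $\mathbf s$-weak order.
   Context: $[n]=\{1,\dots,n\}$, $]i,j[=\{i+1,\dots,j-1\}$, $\mathbf s=(s_1,\dots,s_n)$ with $s_i\in\mathbb N$ (zeros allowed). An $\mathbf s$-tree is a rooted plane tree whose internal nodes are labeled bijectively by $[n]$, the root having one child, and node $j$ having exactly $s_j+1$ ordered children, each a leaf or a node larger than $j$. For $1\le i<j\le n$, $\mathrm{pos}(\mathcal T,i,j)$ is the minimum of $s_i$ and the number of outgoing edges of $i$ strictly to the right of the path from the root of $\mathcal T$ to $j$. The $\mathbf s$-weak order: $\mathcal T\le\mathcal T'$ iff $\mathrm{pos}(\mathcal T,i,j)\le\mathrm{pos}(\mathcal T',i,j)$ for all $i<j$; it is a lattice. An element is join (resp. meet) irreducible if it covers (resp. is covered by) exactly one element. An $\mathbf s$-arc is a quintuple $(i,j,A,B,r)$ with $1\le i<j\le n$, $A\sqcup B=\{k\in\,]i,j[\,:s_k\ne0\}$, and $r\in\{1,\dots,s_i\}$. Combs: for $J\subseteq[n]$, the left (resp. right) $\mathbf s$-comb with nodes $J$ is the increasing tree on $J$ where each $j\in J$ has $s_j+1$ outgoing edges, all leaves except the leftmost (resp. rightmost), which goes to the next larger element of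 $J$ (if any). For an $\mathbf s$-arc $\alpha=(i,j,A,B,r)$, $\mathcal T_\vee(\alpha)$ is obtained by taking the right $\mathbf s$-comb with nodes $[n]\setminus(A\cup\{j\})$ and replacing the $(r+1)$-st outgoing edge of $i$ counted from the right (a leaf) by the right $\mathbf s$-comb with nodes $A\cup\{j\}$; $\mathcal T_\wedge(\alpha)$ is obtained by taking the left $\mathbf s$-comb with nodes $[n]\setminus(B\cup\{j\})$ and replacing the $r$-th outgoing edge of $i$ counted from the right (a leaf) by the left $\mathbf s$-comb with nodes $B\cup\{j\}$. -}

module Defs where

open import Data.Nat using (ℕ; zero; suc; _≤_; _<_; _∸_; _≡ᵇ_; _⊓_)
open import Data.Bool using (Bool; true; false; if_then_else_; _∨_; _∧_; not)
open import Data.List using (List; []; _∷_; _++_; length; replicate; upTo; map; allFin; filterᵇ)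
open import Data.List.Relation.Binary.Permutation.Propositional using (_↭_)
open import Data.Vec using (Vec; lookup)
open import Data.Fin using (Fin; toℕ)
open import Data.Fin.Subset using (Subset; _∈_)
open import Data.Unit using (⊤)
open import Data.Product using (_×_; ∃; Σ)
open import Data.Sum using (_⊎_)
open import Relation.Nullary using (¬_)
open import Relation.Binary.PropositionalEquality using (_≡_; _≢_)

-- Plane trees with internal nodes labelled by natural numbers.
-- An s-tree is represented by the subtree hanging from the unique
-- child of its (unlabelled) root.

data Tree : Set where
  leaf : Tree
  node : ℕ → List Tree → Tree

-- s_j for a label j ∈ [n] (labels are 1-based); 0 outside [n] (never used there)
sAt : ∀ {n} → Vec ℕ n → ℕ → ℕ
sAt {zero} _ _ = 0
sAt {suc n} s zero = 0
sAt {suc n} s (suc m) = lookup-or-zero s m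
  where
  lookup-or-zero : ∀ {k} → Vec ℕ k → ℕ → ℕ
  lookup-or-zero Vec.[] _ = 0
  lookup-or-zero (x Vec.∷ xs) zero = x
  lookup-or-zero (x Vec.∷ xs) (suc m) = lookup-or-zero xs m

mutual
  labels : Tree → List ℕ
  labels leaf = []
  labels (node j cs) = j ∷ labelsL cs

  labelsL : List Tree → List ℕ
  labelsL [] = []
  labelsL (c ∷ cs) = labels c ++ labelsL cs

Above : ℕ → Tree → Set
Above j leaf = ⊤
Above j (node k _) = j < k

mutual
  WF : (ℕ → ℕ) → Tree → Set
  WF s leaf = ⊤
  WF s (node j cs) = (length cs ≡ suc (s j)) × AboveL j cs × WFL s cs

  WFL : (ℕ → ℕ) → List Tree → Set
  WFL s [] = ⊤
  WFL s (c ∷ cs) = WF s c × WFL s cs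

  AboveL : ℕ → List Tree → Set
  AboveL j [] = ⊤
  AboveL j (c ∷ cs) = Above j c × AboveL j cs

IsSTree : (n : ℕ) → Vec ℕ n → Tree → Set
IsSTree n s t = (labels t ↭ map suc (upTo n)) × WF (sAt s) t

mutual
  occurs : ℕ → Tree → Bool
  occurs j leaf = false
  occurs j (node k cs) = (k ≡ᵇ j) ∨ occursL j cs

  occursL : ℕ → List Tree → Bool
  occursL j [] = false
  occursL j (c ∷ cs) = occurs j c ∨ occursL j cs

mutual
  degree : ℕ → Tree → ℕ
  degree i leaf = 0
  degree i (node k cs) = if k ≡ᵇ i then length cs else degreeL i cs

  degreeL : ℕ → List Tree → ℕ
  degreeL i [] = 0
  degreeL i (c ∷ cs) = degree i c Data.Nat.+ degreeL i cs

countAfter : ℕ → List Tree → ℕ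
countAfter j [] = 0
countAfter j (c ∷ cs) = if occurs j c then length cs else countAfter j cs

-- rightEdges i j t : number of outgoing edges of node i lying strictly
-- to the right of the path from the top of t to node j (t contains j).
-- Subtrees left of the path contribute nothing; subtrees right of the
-- path contribute all their edges.
mutual
  rightEdges : ℕ → ℕ → Tree → ℕ
  rightEdges i j leaf = 0
  rightEdges i j (node k cs) =
    if k ≡ᵇ i then countAfter j cs else rightEdgesL i j cs

  rightEdgesL : ℕ → ℕ → List Tree → ℕ
  rightEdgesL i j [] = 0
  rightEdgesL i j (c ∷ cs) =
    if occurs j c then rightEdges i j c Data.Nat.+ degreeL i cs
    else rightEdgesL i j cs

pos : ∀ {n} → Vec ℕ n → Tree → ℕ → ℕ → ℕ
pos s t i j = sAt s i ⊓ rightEdges i j t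

_≤[_]_ : ∀ {n} → Tree → Vec ℕ n → Tree → Set
_≤[_]_ {n} t s t' = ∀ i j → 1 ≤ i → i < j → j ≤ n → pos s t i j ≤ pos s t' i j

Covers : (n : ℕ) → Vec ℕ n → Tree → Tree → Set
Covers n s t' t =
  t ≤[ s ] t' × t ≢ t' ×
  (∀ u → IsSTree n s u → t ≤[ s ] u → u ≤[ s ] t' → (u ≡ t ⊎ u ≡ t'))

JoinIrreducible : (n : ℕ) → Vec ℕ n → Tree → Set
JoinIrreducible n s t =
  Σ Tree λ u → (IsSTree n s u × Covers n s t u) ×
    (∀ v → IsSTree n s v → Covers n s t v → v ≡ u)

MeetIrreducible : (n : ℕ) → Vec ℕ n → Tree → Set
MeetIrreducible n s t =
  Σ Tree λ u → (IsSTree n s u × Covers n s u t) ×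
    (∀ v → IsSTree n s v → Covers n s v t → v ≡ u)

-- s-arcs (i, j, A, B, r); the subsets A, B ⊆ [n] are given as
-- Subset n, element k : Fin n standing for the label suc (toℕ k).

record Arc (n : ℕ) (s : Vec ℕ n) : Set where
  field
    i j : ℕ
    1≤i : 1 ≤ i
    i<j : i < j
    j≤n : j ≤ n
    A B : Subset n
    disjoint  : ∀ k → ¬ (k ∈ A × k ∈ B)
    cover→    : ∀ k → (k ∈ A ⊎ k ∈ B) →
                  (i < suc (toℕ k) × suc (toℕ k) < j × lookup s k ≢ 0)
    cover←    : ∀ k → (i < suc (toℕ k) × suc (toℕ k) < j × lookup s k ≢ 0) →
                  (k ∈ A ⊎ k ∈ B)
    r : ℕ
    1≤r : 1 ≤ r
    r≤s : r ≤ sAt s i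

-- equality of arcs = equality of their data (the remaining fields are proofs)
SameArc : ∀ {n s} → Arc n s → Arc n s → Set
SameArc α β = Arc.i α ≡ Arc.i β × Arc.j α ≡ Arc.j β × Arc.A α ≡ Arc.A β ×
              Arc.B α ≡ Arc.B β × Arc.r α ≡ Arc.r β

labelsWhere : (n : ℕ) → (Fin n → Bool) → List ℕ
labelsWhere n p = map (λ k → suc (toℕ k)) (filterᵇ p (allFin n))

rightComb : (ℕ → ℕ) → List ℕ → Tree
rightComb s [] = leaf
rightComb s (j ∷ js) = node j (replicate (s j) leaf ++ (rightComb s js ∷ []))

leftComb : (ℕ → ℕ) → List ℕ → Tree
leftComb s [] = leaf
leftComb s (j ∷ js) = node j (leftComb s js ∷ replicate (s j) leaf)

setAt : ℕ → Tree → List Tree → List Tree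
setAt m u [] = []
setAt zero u (c ∷ cs) = u ∷ cs
setAt (suc m) u (c ∷ cs) = c ∷ setAt m u cs

-- replace the (m+1)-st outgoing edge of node i counted from the right by u
mutual
  graft : ℕ → ℕ → Tree → Tree → Tree
  graft i m u leaf = leaf
  graft i m u (node k cs) =
    if k ≡ᵇ i then node k (setAt (length cs ∸ suc m) u cs)
    else node k (graftL i m u cs)

  graftL : ℕ → ℕ → Tree → List Tree → List Tree
  graftL i m u [] = []
  graftL i m u (c ∷ cs) = graft i m u c ∷ graftL i m u cs

Tjoin : ∀ {n s} → Arc n s → Tree
Tjoin {n} {s} α =
  graft i r (rightComb (sAt s) (labelsWhere n inner))
            (rightComb (sAt s) (labelsWhere n (λ k → not (inner k))))
  where
  open Arc α
  inner : Fin n → Bool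
  inner k = lookup A k ∨ (suc (toℕ k) ≡ᵇ j)

Tmeet : ∀ {n s} → Arc n s → Tree
Tmeet {n} {s} α =
  graft i (r ∸ 1) (leftComb (sAt s) (labelsWhere n inner))
                  (leftComb (sAt s) (labelsWhere n (λ k → not (inner k))))
  where
  open Arc α
  inner : Fin n → Bool
  inner k = lookup B k ∨ (suc (toℕ k) ≡ᵇ j)

BijectionOnto : (n : ℕ) (s : Vec ℕ n) → (Arc n s → Tree) → (Tree → Set) → Set
BijectionOnto n s f P =
  (∀ α → IsSTree n s (f α) × P (f α)) ×
  (∀ α β → f α ≡ f β → SameArc α β) ×
  (∀ t → IsSTree n s t → P t → ∃ λ α → f α ≡ t)

-- An s-tree is determined by its values of pos, and these satisfy the
-- planarity condition.  T_∨(α) is the right comb on [n] ∖ (A ∪ {j}) with the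
-- right comb on A ∪ {j} hung at an edge of i, so its only nonzero values of
-- pos are pos (i, b) = r and pos (a, b) = s_a for b ∈ A ∪ {j} and
-- i < a ∉ A ∪ {j}.
-- Moving j by one step (one edge to the right at i, onto the first node of
-- B = ]i, j[ ∖ A with s_b ≠ 0, or onto the spine) gives a tree that differs
-- only in pos (i, j) = r − 1; by planarity every tree below T_∨(α) either
-- lies below that one or already has pos (i, j) ≥ r and then lies above
-- T_∨(α).  So T_∨(α) is join irreducible, and its nonzero values of pos
-- recover α.  Conversely, a join irreducible T differs from its lower cover
-- at some pair (i, j); reading A and B off the values pos (i, b) of T gives an
-- arc whose T_∨ lies below T but not below the lower cover, hence equals T.
-- Mirror images reverse the order and turn T_∨ of (i, j, B, A, s_i + 1 − r)
-- into T_∧(α), which gives the meet irreducibles.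

{-# OPTIONS --safe #-}
module Submission where

open import Defs
open import Relation.Binary.PropositionalEquality
open import Data.Nat
open import Data.Nat.Properties
open import Data.Bool using (Bool; true; false; if_then_else_; _∨_; _∧_; not; T)
open import Data.Bool.Properties using (∨-conicalˡ; ∨-conicalʳ; ∨-zeroʳ; ∨-identityˡ; ∨-identityʳ; ∨-assoc; ∨-comm; ¬-not; not-involutive; T-≡)
open import Data.List using (List; []; _∷_; _++_; length; replicate; map; upTo; applyUpTo; tabulate; allFin; filterᵇ; concatMap)
open import Data.List.Properties using (length-replicate; length-++; ++-identityʳ; ++-assoc; map-applyUpTo; map-tabulate)
open import Data.List.Membership.Propositional using (_∈_; _∉_)
open import Data.List.Membership.Propositional.Properties using (∈-++⁺ˡ; ∈-++⁺ʳ; ∈-++⁻)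
open import Data.List.Relation.Unary.Any as Any using (here; there)
open import Data.List.Relation.Unary.All as All using (All; []; _∷_)
open import Data.List.Relation.Unary.All.Properties using () renaming (++⁻ˡ to All++⁻ˡ; ++⁻ʳ to All++⁻ʳ)
open import Data.List.Relation.Unary.AllPairs as AllPairs using (AllPairs; []; _∷_)
open import Data.List.Relation.Unary.Unique.Propositional using (Unique)
open import Data.List.Relation.Unary.Unique.Propositional.Properties using () renaming (++⁺ to Unique++⁺)
open import Data.List.Relation.Binary.BagAndSetEquality using (∼bag⇒↭)
open import Data.List.Membership.Propositional.Properties.WithK using (unique∧set⇒bag)
open import Data.List.Relation.Binary.Permutation.Propositional using (_↭_; prep; ↭-refl; ↭-trans; ↭-sym)
open import Data.List.Relation.Binary.Permutation.Propositional.Properties using (++⁺ˡ; ++⁺ʳ; ++-comm; shift; shifts; ∈-resp-↭)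
open import Data.List.Relation.Binary.Permutation.Propositional using (↭⇒↭ₛ)
open import Data.List.Relation.Binary.Permutation.Setoid.Properties (setoid ℕ) using (Unique-resp-↭)
open import Data.Vec as Vec using (Vec; []; _∷_; lookup)
open import Data.Vec.Properties using ([]=⇒lookup; lookup⇒[]=; tabulate∘lookup; lookup∘tabulate) renaming (tabulate-cong to Vec-tabulate-cong)
open import Data.Fin.Subset using (Subset) renaming (_∈_ to _∈ₛ_)
open import Data.Fin using (Fin; toℕ) renaming (zero to fzero; suc to fsuc)
open import Data.Product as Product using (Σ; ∃; _×_; _,_; proj₁; proj₂)
open import Data.Sum as Sum using (_⊎_; inj₁; inj₂; [_,_]′)
open import Data.Unit using (⊤; tt)
open import Data.Empty using (⊥; ⊥-elim)
open import Function.Base using (id; _∘_; case_of_)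
open import Function.Bundles using (Equivalence; mk⇔)
open import Relation.Nullary using (¬_; Dec; yes; no)
open import Relation.Binary.Definitions using (tri<; tri≈; tri>)

≡ᵇ-true⇒≡ : ∀ m n → (m ≡ᵇ n) ≡ true → m ≡ n
≡ᵇ-true⇒≡ m n e = ≡ᵇ⇒≡ m n (Equivalence.from T-≡ e)

≡ᵇ-refl : ∀ m → (m ≡ᵇ m) ≡ true
≡ᵇ-refl m = Equivalence.to T-≡ (≡⇒≡ᵇ m m refl)

≡ᵇ-false⇒≢ : ∀ m n → (m ≡ᵇ n) ≡ false → m ≢ n
≡ᵇ-false⇒≢ m n e m≡n = subst T e (≡⇒≡ᵇ m n m≡n)

≢⇒≡ᵇ-false : ∀ m n → m ≢ n → (m ≡ᵇ n) ≡ false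
≢⇒≡ᵇ-false m n m≢n = ¬-not (λ e → m≢n (≡ᵇ-true⇒≡ m n e))

<⇒<ᵇ-true : ∀ {m n} → m < n → (m <ᵇ n) ≡ true
<⇒<ᵇ-true m<n = Equivalence.to T-≡ (<⇒<ᵇ m<n)

≤⇒<ᵇ-false : ∀ {m n} → n ≤ m → (m <ᵇ n) ≡ false
≤⇒<ᵇ-false {m} {n} n≤m = ¬-not (λ e → ≤⇒≯ n≤m (<ᵇ⇒< m n (Equivalence.from T-≡ e)))

<ᵇ-true⇒< : ∀ {m n} → (m <ᵇ n) ≡ true → m < n
<ᵇ-true⇒< {m} {n} e = <ᵇ⇒< m n (Equivalence.from T-≡ e)

∨-true-split : ∀ a b → a ∨ b ≡ true → a ≡ true ⊎ b ≡ true
∨-true-split true  _ _ = inj₁ refl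
∨-true-split false _ e = inj₂ e

∨-false-split : ∀ a b → a ∨ b ≡ false → a ≡ false × b ≡ false
∨-false-split a b e = ∨-conicalˡ a b e , ∨-conicalʳ a b e

∨-trueʳ : ∀ a {b} → b ≡ true → a ∨ b ≡ true
∨-trueʳ a refl = ∨-zeroʳ a

∧-true-split : ∀ a b → a ∧ b ≡ true → a ≡ true × b ≡ true
∧-true-split true true _ = refl , refl

true≢false : ∀ {b} → b ≡ true → b ≡ false → ⊥
true≢false refl ()

Bool-≡-from-⇔ : ∀ {a b : Bool} → (a ≡ true → b ≡ true) → (b ≡ true → a ≡ true) → a ≡ b
Bool-≡-from-⇔ {true}  {true}  _ _ = refl
Bool-≡-from-⇔ {false} {false} _ _ = refl
Bool-≡-from-⇔ {true}  {false} f _ = sym (f refl)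
Bool-≡-from-⇔ {false} {true}  _ g = g refl

mutual
  DistinctLabels : Tree → Set
  DistinctLabels leaf = ⊤
  DistinctLabels (node k cs) = occursL k cs ≡ false × DistinctLabelsL cs

  DistinctLabelsL : List Tree → Set
  DistinctLabelsL [] = ⊤
  DistinctLabelsL (c ∷ cs) =
    DistinctLabels c × DistinctLabelsL cs × (∀ b → occurs b c ≡ true → occursL b cs ≡ false)

occurs-root : ∀ k cs → occurs k (node k cs) ≡ true
occurs-root k cs rewrite ≡ᵇ-refl k = refl

occurs-child : ∀ k b cs → occursL b cs ≡ true → occurs b (node k cs) ≡ true
occurs-child k b cs = ∨-trueʳ (k ≡ᵇ b)

occursL-here : ∀ b c cs → occurs b c ≡ true → occursL b (c ∷ cs) ≡ true
occursL-here b c cs e rewrite e = refl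

occursL-there : ∀ b c cs → occursL b cs ≡ true → occursL b (c ∷ cs) ≡ true
occursL-there b c cs = ∨-trueʳ (occurs b c)

not-in-head : ∀ b c cs → (∀ b → occurs b c ≡ true → occursL b cs ≡ false) →
              occursL b cs ≡ true → occurs b c ≡ false
not-in-head b c cs disj e = ¬-not (λ e′ → true≢false e (disj b e′))

countAfter-here : ∀ b c cs → occurs b c ≡ true → countAfter b (c ∷ cs) ≡ length cs
countAfter-here b c cs e rewrite e = refl

countAfter-there : ∀ b c cs → occurs b c ≡ false → countAfter b (c ∷ cs) ≡ countAfter b cs
countAfter-there b c cs e rewrite e = refl

countAfter<length : ∀ b cs → occursL b cs ≡ true → countAfter b cs < length cs
countAfter<length b (c ∷ cs) e with occurs b c
... | true  = ≤-refl
... | false = m<n⇒m<1+n (countAfter<length b cs e)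

countAfter-absent : ∀ b cs → occursL b cs ≡ false → countAfter b cs ≡ 0
countAfter-absent b [] e = refl
countAfter-absent b (c ∷ cs) e with ∨-false-split (occurs b c) (occursL b cs) e
... | e₁ , e₂ rewrite e₁ = countAfter-absent b cs e₂

rightEdges-root : ∀ k b cs → rightEdges k b (node k cs) ≡ countAfter b cs
rightEdges-root k b cs rewrite ≡ᵇ-refl k = refl

rightEdges-nonroot : ∀ k a b cs → k ≢ a → rightEdges a b (node k cs) ≡ rightEdgesL a b cs
rightEdges-nonroot k a b cs k≢a rewrite ≢⇒≡ᵇ-false k a k≢a = refl

rightEdgesL-here : ∀ a b c cs → occurs b c ≡ true →
                   rightEdgesL a b (c ∷ cs) ≡ rightEdges a b c + degreeL a cs
rightEdgesL-here a b c cs e rewrite e = refl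

rightEdgesL-there : ∀ a b c cs → occurs b c ≡ false → rightEdgesL a b (c ∷ cs) ≡ rightEdgesL a b cs
rightEdgesL-there a b c cs e rewrite e = refl

rightEdgesL-target-absent : ∀ a b cs → occursL b cs ≡ false → rightEdgesL a b cs ≡ 0
rightEdgesL-target-absent a b [] e = refl
rightEdgesL-target-absent a b (c ∷ cs) e with ∨-false-split (occurs b c) (occursL b cs) e
... | e₁ , e₂ rewrite e₁ = rightEdgesL-target-absent a b cs e₂

mutual
  rightEdges-absent : ∀ a b t → occurs a t ≡ false → rightEdges a b t ≡ 0
  rightEdges-absent a b leaf e = refl
  rightEdges-absent a b (node k cs) e with ∨-false-split (k ≡ᵇ a) (occursL a cs) e
  ... | e₁ , e₂ rewrite e₁ = rightEdgesL-absent a b cs e₂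

  rightEdgesL-absent : ∀ a b cs → occursL a cs ≡ false → rightEdgesL a b cs ≡ 0
  rightEdgesL-absent a b [] e = refl
  rightEdgesL-absent a b (c ∷ cs) e with ∨-false-split (occurs a c) (occursL a cs) e
  ... | e₁ , e₂ with occurs b c
  ... | true  rewrite rightEdges-absent a b c e₁ | degreeL-absent a cs e₂ = refl
  ... | false = rightEdgesL-absent a b cs e₂

  degree-absent : ∀ a t → occurs a t ≡ false → degree a t ≡ 0
  degree-absent a leaf e = refl
  degree-absent a (node k cs) e with ∨-false-split (k ≡ᵇ a) (occursL a cs) e
  ... | e₁ , e₂ rewrite e₁ = degreeL-absent a cs e₂

  degreeL-absent : ∀ a cs → occursL a cs ≡ false → degreeL a cs ≡ 0
  degreeL-absent a [] e = refl
  degreeL-absent a (c ∷ cs) e with ∨-false-split (occurs a c) (occursL a cs) e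
  ... | e₁ , e₂ rewrite degree-absent a c e₁ | degreeL-absent a cs e₂ = refl

rightEdgesL-here-only : ∀ a b c cs → DistinctLabelsL (c ∷ cs) → occurs a c ≡ true → occurs b c ≡ true →
                        rightEdgesL a b (c ∷ cs) ≡ rightEdges a b c
rightEdgesL-here-only a b c cs (_ , _ , disj) ea eb
  rewrite rightEdgesL-here a b c cs eb | degreeL-absent a cs (disj a ea) = +-identityʳ _


-- Addresses of labels: the list of child indices (from the left) on the
-- path from the top of a tree to the node.

mutual
  data At : ℕ → List ℕ → Tree → Set where
    at-root  : ∀ {k cs} → At k [] (node k cs)
    at-child : ∀ {b x p k cs} → AtL b x p cs → At b (x ∷ p) (node k cs)

  data AtL : ℕ → ℕ → List ℕ → List Tree → Set where
    at-here  : ∀ {b p c cs} → At b p c → AtL b 0 p (c ∷ cs)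
    at-there : ∀ {b x p c cs} → AtL b x p cs → AtL b (suc x) p (c ∷ cs)

-- edgesRightOf p q d: how many of the d outgoing edges of the node at
-- address p lie strictly to the right of the path to the address q.
edgesRightOf : List ℕ → List ℕ → ℕ → ℕ
edgesRightOf []      []      d = 0
edgesRightOf []      (y ∷ q) d = d ∸ suc y
edgesRightOf (x ∷ p) []      d = 0
edgesRightOf (x ∷ p) (y ∷ q) d = if x ≡ᵇ y then edgesRightOf p q d else (if y <ᵇ x then d else 0)

edgesRightOf-same : ∀ x p q d → edgesRightOf (x ∷ p) (x ∷ q) d ≡ edgesRightOf p q d
edgesRightOf-same x p q d rewrite ≡ᵇ-refl x = refl

edgesRightOf-< : ∀ {x y} p q d → x < y → edgesRightOf (x ∷ p) (y ∷ q) d ≡ 0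
edgesRightOf-< {x} {y} p q d x<y rewrite ≢⇒≡ᵇ-false x y (<⇒≢ x<y) | ≤⇒<ᵇ-false {y} {x} (<⇒≤ x<y) = refl

edgesRightOf-> : ∀ {x y} p q d → y < x → edgesRightOf (x ∷ p) (y ∷ q) d ≡ d
edgesRightOf-> {x} {y} p q d y<x rewrite ≢⇒≡ᵇ-false x y (>⇒≢ y<x) | <⇒<ᵇ-true y<x = refl

mutual
  At⇒occurs : ∀ {b p t} → At b p t → occurs b t ≡ true
  At⇒occurs {b} (at-root {cs = cs}) = occurs-root b cs
  At⇒occurs {b} (at-child {k = k} {cs} a) = occurs-child k b cs (AtL⇒occursL a)

  AtL⇒occursL : ∀ {b x p cs} → AtL b x p cs → occursL b cs ≡ true
  AtL⇒occursL {b} (at-here {c = c} {cs} a) = occursL-here b c cs (At⇒occurs a)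
  AtL⇒occursL {b} (at-there {c = c} {cs} a) = occursL-there b c cs (AtL⇒occursL a)

countAfter-at : ∀ {b x p cs} → DistinctLabelsL cs → AtL b x p cs → countAfter b cs ≡ length cs ∸ suc x
countAfter-at {b} _ (at-here {c = c} {cs} a) rewrite At⇒occurs a = refl
countAfter-at {b} (_ , d , disj) (at-there {c = c} {cs} a)
  rewrite not-in-head b c cs disj (AtL⇒occursL a) = countAfter-at d a
module WellFormed (σ : ℕ → ℕ) where

  mutual
    degree-present : ∀ a t → WF σ t → DistinctLabels t → occurs a t ≡ true → degree a t ≡ suc (σ a)
    degree-present a (node k cs) (len , _ , wl) (_ , dl) e with k ≡ᵇ a in k≡ᵇa
    ... | true with ≡ᵇ-true⇒≡ k a k≡ᵇa
    ...   | refl = len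
    degree-present a (node k cs) (len , _ , wl) (_ , dl) e | false = degreeL-present a cs wl dl e

    degreeL-present : ∀ a cs → WFL σ cs → DistinctLabelsL cs → occursL a cs ≡ true →
                      degreeL a cs ≡ suc (σ a)
    degreeL-present a (c ∷ cs) (w₁ , w₂) (d₁ , d₂ , disj) e with occurs a c in eac
    ... | true  rewrite degree-present a c w₁ d₁ eac | degreeL-absent a cs (disj a eac) = +-identityʳ _
    ... | false rewrite degree-absent a c eac = degreeL-present a cs w₂ d₂ e

  mutual
    above-descendants : ∀ k t → Above k t → WF σ t → ∀ b → occurs b t ≡ true → k < b
    above-descendants k (node k′ cs) k<k′ (_ , abl , wl) b e with ∨-true-split (k′ ≡ᵇ b) (occursL b cs) e
    ... | inj₁ e₁ rewrite ≡ᵇ-true⇒≡ k′ b e₁ = k<k′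
    ... | inj₂ e₂ = <-trans k<k′ (aboveL-descendants k′ cs abl wl b e₂)

    aboveL-descendants : ∀ k cs → AboveL k cs → WFL σ cs → ∀ b → occursL b cs ≡ true → k < b
    aboveL-descendants k (c ∷ cs) (a₁ , a₂) (w₁ , w₂) b e with ∨-true-split (occurs b c) (occursL b cs) e
    ... | inj₁ e₁ = above-descendants k c a₁ w₁ b e₁
    ... | inj₂ e₂ = aboveL-descendants k cs a₂ w₂ b e₂

  root-minimal : ∀ k cs → WF σ (node k cs) → ∀ b → occurs b (node k cs) ≡ true → k ≤ b
  root-minimal k cs (_ , abl , wl) b e with ∨-true-split (k ≡ᵇ b) (occursL b cs) e
  ... | inj₁ e₁ rewrite ≡ᵇ-true⇒≡ k b e₁ = ≤-refl
  ... | inj₂ e₂ = <⇒≤ (aboveL-descendants k cs abl wl b e₂)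

  planarity-at-root : ∀ x y z cs → WFL σ cs → DistinctLabelsL cs →
    occursL y cs ≡ true → occursL z cs ≡ true →
    σ x ⊓ countAfter y cs < σ x ⊓ countAfter z cs → σ y ≤ rightEdgesL y z cs
  planarity-at-root x y z (c ∷ cs) (w₁ , w₂) (d₁ , d₂ , disj) ey ez lt with occurs z c | occurs y c
  ... | true  | true  = ⊥-elim (<-irrefl refl lt)
  ... | true  | false rewrite degreeL-present y cs w₂ d₂ ey = ≤-trans (n≤1+n (σ y)) (m≤n+m _ _)
  ... | false | true  = ⊥-elim (<⇒≱ lt (⊓-monoʳ-≤ (σ x) (<⇒≤ (countAfter<length z cs ez))))
  ... | false | false = planarity-at-root x y z cs w₂ d₂ ey ez lt

  -- The planarity condition of s-tree inversions: if, seen from x, z lies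
  -- further left than y, then y lies on the left of the path to z.
  mutual
    planarity : ∀ x y z t → WF σ t → DistinctLabels t → x < y → y < z →
      occurs x t ≡ true → occurs y t ≡ true → occurs z t ≡ true →
      σ x ⊓ rightEdges x y t < σ x ⊓ rightEdges x z t → σ y ≤ rightEdges y z t
    planarity x y z (node k cs) w@(_ , _ , wl) (_ , dl) x<y y<z ex ey ez lt with k ≡ᵇ x in k≡ᵇx
    ... | true with ≡ᵇ-true⇒≡ k x k≡ᵇx
    ...   | refl rewrite ≢⇒≡ᵇ-false k y (<⇒≢ x<y) =
      planarity-at-root x y z cs wl dl ey
        (subst (λ b → b ∨ occursL z cs ≡ true) (≢⇒≡ᵇ-false k z (<⇒≢ (<-trans x<y y<z))) ez) lt
    planarity x y z (node k cs) w@(_ , _ , wl) (_ , dl) x<y y<z ex ey ez lt | false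
      with root-minimal k cs w x (occurs-child k x cs ex)
    ... | k≤x
      rewrite ≢⇒≡ᵇ-false k y (λ k≡y → <⇒≱ x<y (subst (_≤ x) k≡y k≤x))
            | ≢⇒≡ᵇ-false k z (λ k≡z → <⇒≱ (<-trans x<y y<z) (subst (_≤ x) k≡z k≤x)) =
      planarityL x y z cs wl dl x<y y<z ex ey ez lt

    planarityL : ∀ x y z cs → WFL σ cs → DistinctLabelsL cs → x < y → y < z →
      occursL x cs ≡ true → occursL y cs ≡ true → occursL z cs ≡ true →
      σ x ⊓ rightEdgesL x y cs < σ x ⊓ rightEdgesL x z cs → σ y ≤ rightEdgesL y z cs
    planarityL x y z (c ∷ cs) (w₁ , w₂) (d₁ , d₂ , disj) x<y y<z ex ey ez lt
      with occurs y c in eyc | occurs z c in ezc | occurs x c in exc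
    ... | true | true | true
      rewrite degreeL-absent x cs (disj x exc) | degreeL-absent y cs (disj y eyc)
            | +-identityʳ (rightEdges x y c) | +-identityʳ (rightEdges x z c) | +-identityʳ (rightEdges y z c)
      = planarity x y z c w₁ d₁ x<y y<z exc eyc ezc lt
    ... | true | true | false
      rewrite rightEdges-absent x y c exc | rightEdges-absent x z c exc = ⊥-elim (<-irrefl refl lt)
    ... | true | false | true
      rewrite degreeL-absent x cs (disj x exc) | rightEdgesL-absent x z cs (disj x exc) | ⊓-zeroʳ (σ x)
      = ⊥-elim (n≮0 lt)
    ... | true | false | false
      rewrite rightEdges-absent x y c exc | degreeL-present x cs w₂ d₂ ex
      = ⊥-elim (<⇒≱ lt (≤-trans (m⊓n≤m (σ x) _) (≤-reflexive (sym (m≤n⇒m⊓n≡m (n≤1+n (σ x)))))))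
    ... | false | true | _ rewrite degreeL-present y cs w₂ d₂ ey = ≤-trans (n≤1+n (σ y)) (m≤n+m _ _)
    ... | false | false | true
      rewrite rightEdgesL-absent x y cs (disj x exc) | rightEdgesL-absent x z cs (disj x exc) | ⊓-zeroʳ (σ x)
      = ⊥-elim (n≮0 lt)
    ... | false | false | false = planarityL x y z cs w₂ d₂ x<y y<z ex ey ez lt

  private
    head-occurrence-determined : ∀ b c cs c′ cs′ → length cs ≡ length cs′ →
      occursL b (c ∷ cs) ≡ occursL b (c′ ∷ cs′) →
      countAfter b (c ∷ cs) ≡ countAfter b (c′ ∷ cs′) →
      occurs b c ≡ true → occurs b c′ ≡ true
    head-occurrence-determined b c cs c′ cs′ len same-occ same-ca e with occurs b c′ in e′
    ... | true  = refl
    ... | false = ⊥-elim (<-irrefl (sym len′≡ca′) (countAfter<length b cs′ in-cs′))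
      where
      in-cs′ : occursL b cs′ ≡ true
      in-cs′ = trans (sym same-occ) (occursL-here b c cs e)
      len′≡ca′ : length cs′ ≡ countAfter b cs′
      len′≡ca′ = trans (sym len) (trans (sym (countAfter-here b c cs e)) same-ca)

  -- The root is the least label, and pos at the root tells in which child
  -- each other label lies.
  mutual
    pos-determines-tree : ∀ t t′ → WF σ t → WF σ t′ → DistinctLabels t → DistinctLabels t′ →
      (∀ b → occurs b t ≡ occurs b t′) →
      (∀ a b → a < b → occurs a t ≡ true → occurs b t ≡ true →
         σ a ⊓ rightEdges a b t ≡ σ a ⊓ rightEdges a b t′) →
      t ≡ t′
    pos-determines-tree leaf leaf _ _ _ _ _ _ = refl
    pos-determines-tree leaf (node k′ cs′) _ _ _ _ occ _ = ⊥-elim (true≢false (occurs-root k′ cs′) (sym (occ k′)))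
    pos-determines-tree (node k cs) leaf _ _ _ _ occ _ = ⊥-elim (true≢false (occurs-root k cs) (occ k))
    pos-determines-tree (node k cs) (node k′ cs′) w@(len , abl , wl) w′@(len′ , _ , wl′) (dk , dl) (dk′ , dl′) occ pe
      with ≤-antisym (root-minimal k cs w k′ (trans (occ k′) (occurs-root k′ cs′)))
                     (root-minimal k′ cs′ w′ k (trans (sym (occ k)) (occurs-root k cs)))
    ... | refl = cong (node k) (pos-determines-children cs cs′ wl wl′ dl dl′ (trans len (sym len′)) occL caL peL)
      where
      occL : ∀ b → occursL b cs ≡ occursL b cs′
      occL b with k ≡ᵇ b in k≡ᵇb | occ b
      ... | false | o = o
      ... | true  | _ with ≡ᵇ-true⇒≡ k b k≡ᵇb
      ...   | refl = trans dk (sym dk′)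
      k<label : ∀ b → occursL b cs ≡ true → k < b
      k<label b = aboveL-descendants k cs abl wl b
      caL : ∀ b → occursL b cs ≡ true → countAfter b cs ≡ countAfter b cs′
      caL b e = begin
        countAfter b cs                       ≡⟨ m≥n⇒m⊓n≡n (ca≤ cs len e) ⟨
        σ k ⊓ countAfter b cs                 ≡⟨ cong (σ k ⊓_) (rightEdges-root k b cs) ⟨
        σ k ⊓ rightEdges k b (node k cs)      ≡⟨ pe k b (k<label b e) (occurs-root k cs) (occurs-child k b cs e) ⟩
        σ k ⊓ rightEdges k b (node k cs′)     ≡⟨ cong (σ k ⊓_) (rightEdges-root k b cs′) ⟩
        σ k ⊓ countAfter b cs′                ≡⟨ m≥n⇒m⊓n≡n (ca≤ cs′ len′ (trans (sym (occL b)) e)) ⟩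
        countAfter b cs′                      ∎
        where
        open ≡-Reasoning
        ca≤ : ∀ ds → length ds ≡ suc (σ k) → occursL b ds ≡ true → countAfter b ds ≤ σ k
        ca≤ ds l e = ≤-pred (≤-trans (countAfter<length b ds e) (≤-reflexive l))
      peL : ∀ a b → a < b → occursL a cs ≡ true → occursL b cs ≡ true →
            σ a ⊓ rightEdgesL a b cs ≡ σ a ⊓ rightEdgesL a b cs′
      peL a b a<b ea eb = begin
        σ a ⊓ rightEdgesL a b cs             ≡⟨ cong (σ a ⊓_) (rightEdges-nonroot k a b cs k≢a) ⟨
        σ a ⊓ rightEdges a b (node k cs)     ≡⟨ pe a b a<b (occurs-child k a cs ea) (occurs-child k b cs eb) ⟩
        σ a ⊓ rightEdges a b (node k cs′)    ≡⟨ cong (σ a ⊓_) (rightEdges-nonroot k a b cs′ k≢a) ⟩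
        σ a ⊓ rightEdgesL a b cs′            ∎
        where
        open ≡-Reasoning
        k≢a : k ≢ a
        k≢a k≡a = <-irrefl k≡a (k<label a ea)

    pos-determines-children : ∀ cs cs′ → WFL σ cs → WFL σ cs′ → DistinctLabelsL cs → DistinctLabelsL cs′ →
      length cs ≡ length cs′ →
      (∀ b → occursL b cs ≡ occursL b cs′) →
      (∀ b → occursL b cs ≡ true → countAfter b cs ≡ countAfter b cs′) →
      (∀ a b → a < b → occursL a cs ≡ true → occursL b cs ≡ true →
         σ a ⊓ rightEdgesL a b cs ≡ σ a ⊓ rightEdgesL a b cs′) →
      cs ≡ cs′
    pos-determines-children [] [] _ _ _ _ _ _ _ _ = refl
    pos-determines-children (c ∷ cs) (c′ ∷ cs′) (w₁ , w₂) (w₁′ , w₂′) d@(d₁ , d₂ , disj) d′@(d₁′ , d₂′ , disj′)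
                            len occ ca pe =
      cong₂ _∷_ (pos-determines-tree c c′ w₁ w₁′ d₁ d₁′ occ-head pe-head)
                (pos-determines-children cs cs′ w₂ w₂′ d₂ d₂′ len′ occ-tail ca-tail pe-tail)
      where
      len′ = suc-injective len
      occ-head : ∀ b → occurs b c ≡ occurs b c′
      occ-head b = Bool-≡-from-⇔
        (λ e → head-occurrence-determined b c cs c′ cs′ len′ (occ b) (ca b (occursL-here b c cs e)) e)
        (λ e → head-occurrence-determined b c′ cs′ c cs (sym len′) (sym (occ b))
                 (sym (ca b (trans (occ b) (occursL-here b c′ cs′ e)))) e)
      pe-head : ∀ a b → a < b → occurs a c ≡ true → occurs b c ≡ true →
                σ a ⊓ rightEdges a b c ≡ σ a ⊓ rightEdges a b c′
      pe-head a b a<b ea eb = begin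
        σ a ⊓ rightEdges a b c             ≡⟨ cong (σ a ⊓_) (rightEdgesL-here-only a b c cs d ea eb) ⟨
        σ a ⊓ rightEdgesL a b (c ∷ cs)     ≡⟨ pe a b a<b (occursL-here a c cs ea) (occursL-here b c cs eb) ⟩
        σ a ⊓ rightEdgesL a b (c′ ∷ cs′)   ≡⟨ cong (σ a ⊓_) (rightEdgesL-here-only a b c′ cs′ d′
                                                 (trans (sym (occ-head a)) ea) (trans (sym (occ-head b)) eb)) ⟩
        σ a ⊓ rightEdges a b c′            ∎
        where open ≡-Reasoning
      occ-tail : ∀ b → occursL b cs ≡ occursL b cs′
      occ-tail b with occurs b c in e
      ... | true  = trans (disj b e) (sym (disj′ b (trans (sym (occ-head b)) e)))
      ... | false = trans (sym (∨-identityˡ _)) (trans (cong (_∨ occursL b cs) (sym e))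
                      (trans (occ b) (cong (_∨ occursL b cs′) (trans (sym (occ-head b)) e))))
      ca-tail : ∀ b → occursL b cs ≡ true → countAfter b cs ≡ countAfter b cs′
      ca-tail b e = trans (sym (countAfter-there b c cs ∉c)) (trans (ca b (occursL-there b c cs e))
                      (countAfter-there b c′ cs′ (trans (sym (occ-head b)) ∉c)))
        where ∉c = not-in-head b c cs disj e
      pe-tail : ∀ a b → a < b → occursL a cs ≡ true → occursL b cs ≡ true →
                σ a ⊓ rightEdgesL a b cs ≡ σ a ⊓ rightEdgesL a b cs′
      pe-tail a b a<b ea eb =
        trans (cong (σ a ⊓_) (sym (rightEdgesL-there a b c cs ∉c)))
          (trans (pe a b a<b (occursL-there a c cs ea) (occursL-there b c cs eb))
            (cong (σ a ⊓_) (rightEdgesL-there a b c′ cs′ (trans (sym (occ-head b)) ∉c))))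
        where ∉c = not-in-head b c cs disj eb

  mutual
    rightEdges-address : ∀ {a b p q t} → WF σ t → DistinctLabels t → At a p t → At b q t →
                         rightEdges a b t ≡ edgesRightOf p q (suc (σ a))
    rightEdges-address {a} _ (dk , _) (at-root {cs = cs}) at-root
      rewrite rightEdges-root a a cs = countAfter-absent a cs dk
    rightEdges-address {a} {b} (len , _) (_ , dl) (at-root {cs = cs}) (at-child bl)
      rewrite rightEdges-root a b cs | countAfter-at dl bl | len = refl
    rightEdges-address {a} _ (dk , _) (at-child {k = k} {cs = cs} al) at-root
      rewrite rightEdges-nonroot k a k cs (root≢descendant al dk) = rightEdgesL-target-absent a k cs dk
    rightEdges-address {a} {b} (_ , _ , wl) (dk , dl) (at-child {k = k} {cs = cs} al) (at-child bl)
      rewrite rightEdges-nonroot k a b cs (root≢descendant al dk) = rightEdgesL-address wl dl al bl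

    rightEdgesL-address : ∀ {a b x y p q cs} → WFL σ cs → DistinctLabelsL cs → AtL a x p cs → AtL b y q cs →
                          rightEdgesL a b cs ≡ edgesRightOf (x ∷ p) (y ∷ q) (suc (σ a))
    rightEdgesL-address {a} {b} (w₁ , _) (d₁ , _ , disj) (at-here {c = c} {cs} al) (at-here bl)
      rewrite rightEdgesL-here a b c cs (At⇒occurs bl) | degreeL-absent a cs (disj a (At⇒occurs al))
            | +-identityʳ (rightEdges a b c) = rightEdges-address w₁ d₁ al bl
    rightEdgesL-address {a} {b} _ (_ , _ , disj) (at-here {c = c} {cs} al) (at-there bl)
      rewrite rightEdgesL-there a b c cs (not-in-head b c cs disj (AtL⇒occursL bl))
      = rightEdgesL-absent a b cs (disj a (At⇒occurs al))
    rightEdgesL-address {a} {b} {suc x} (_ , w₂) (_ , d₂ , disj) (at-there {c = c} {cs} al) (at-here bl)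
      rewrite rightEdgesL-here a b c cs (At⇒occurs bl) | rightEdges-absent a b c (not-in-head a c cs disj (AtL⇒occursL al))
            | degreeL-present a cs w₂ d₂ (AtL⇒occursL al) = refl
    rightEdgesL-address {a} {b} (_ , w₂) (_ , d₂ , disj) (at-there {c = c} {cs} al) (at-there bl)
      rewrite rightEdgesL-there a b c cs (not-in-head b c cs disj (AtL⇒occursL bl)) = rightEdgesL-address w₂ d₂ al bl

    root≢descendant : ∀ {a x p k cs} → AtL a x p cs → occursL k cs ≡ false → k ≢ a
    root≢descendant al k∉cs refl = true≢false (AtL⇒occursL al) k∉cs

-- Combs

Ascending : List ℕ → Set
Ascending = AllPairs _<_

∈-tail : ∀ {l b : ℕ} {L} → b ∈ l ∷ L → (l ≡ᵇ b) ≡ false → b ∈ L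
∈-tail b∈ l≢b = Any.tail (λ b≡l → ≡ᵇ-false⇒≢ _ _ l≢b (sym b≡l)) b∈

AtL-++ : ∀ pre {b x p cs} → AtL b x p cs → AtL b (length pre + x) p (pre ++ cs)
AtL-++ [] a = a
AtL-++ (c ∷ pre) a = at-there (AtL-++ pre a)

AtL-last : ∀ pre {b p c} → At b p c → AtL b (length pre) p (pre ++ c ∷ [])
AtL-last pre {b} {p} {c} a = subst (λ x → AtL b x p (pre ++ c ∷ [])) (+-identityʳ (length pre)) (AtL-++ pre (at-here a))

length-snoc : ∀ {A : Set} (xs : List A) (y : A) m → length xs ≡ m → length (xs ++ y ∷ []) ≡ suc m
length-snoc xs y m e rewrite length-++ xs {y ∷ []} | e = +-comm m 1

AboveL-++ : ∀ k xs ys → AboveL k xs → AboveL k ys → AboveL k (xs ++ ys)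
AboveL-++ k [] ys _ b = b
AboveL-++ k (x ∷ xs) ys (a₁ , a₂) b = a₁ , AboveL-++ k xs ys a₂ b

WFL-++ : ∀ σ xs ys → WFL σ xs → WFL σ ys → WFL σ (xs ++ ys)
WFL-++ σ [] ys _ b = b
WFL-++ σ (x ∷ xs) ys (a₁ , a₂) b = a₁ , WFL-++ σ xs ys a₂ b

AboveL-leaves : ∀ k m → AboveL k (replicate m leaf)
AboveL-leaves k zero = tt
AboveL-leaves k (suc m) = tt , AboveL-leaves k m

WFL-leaves : ∀ σ m → WFL σ (replicate m leaf)
WFL-leaves σ zero = tt
WFL-leaves σ (suc m) = tt , WFL-leaves σ m

labelsL-++ : ∀ xs ys → labelsL (xs ++ ys) ≡ labelsL xs ++ labelsL ys
labelsL-++ [] ys = refl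
labelsL-++ (x ∷ xs) ys rewrite labelsL-++ xs ys = sym (++-assoc (labels x) (labelsL xs) (labelsL ys))

labelsL-leaves : ∀ m → labelsL (replicate m leaf) ≡ []
labelsL-leaves zero = refl
labelsL-leaves (suc m) = labelsL-leaves m

graftL-leaves : ∀ i r X m Z → graftL i r X (replicate m leaf ++ Z) ≡ replicate m leaf ++ graftL i r X Z
graftL-leaves i r X zero Z = refl
graftL-leaves i r X (suc m) Z = cong (leaf ∷_) (graftL-leaves i r X m Z)

concatMap-[] : ∀ (D : ℕ → List ℕ) os → All (λ o → D o ≡ []) os → concatMap D os ≡ []
concatMap-[] D [] _ = refl
concatMap-[] D (o ∷ os) (h ∷ hs) rewrite h | concatMap-[] D os hs = refl

concatMap-single : ∀ (D : ℕ → List ℕ) os c → Ascending os → c ∈ os →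
                   (∀ o → o ∈ os → o ≢ c → D o ≡ []) → concatMap D os ≡ D c
concatMap-single D (o ∷ os) c (o< ∷ asc) (here refl) h =
  trans (cong (D o ++_) (concatMap-[] D os (All.tabulate (λ {x} x∈ → h x (there x∈) (>⇒≢ (All.lookup o< x∈))))))
        (++-identityʳ _)
concatMap-single D (o ∷ os) c (o< ∷ asc) (there c∈) h
  rewrite h o (here refl) (<⇒≢ (All.lookup o< c∈)) = concatMap-single D os c asc c∈ (λ x x∈ → h x (there x∈))

concatMap-pair : ∀ (D : ℕ → List ℕ) os c₁ c₂ → Ascending os → c₁ ∈ os → c₂ ∈ os → c₁ < c₂ →
                 (∀ o → o ∈ os → o ≢ c₁ → o ≢ c₂ → D o ≡ []) → concatMap D os ≡ D c₁ ++ D c₂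
concatMap-pair D (o ∷ os) c₁ c₂ (o< ∷ asc) (here refl) (here refl) c₁<c₂ h = ⊥-elim (<-irrefl refl c₁<c₂)
concatMap-pair D (o ∷ os) c₁ c₂ (o< ∷ asc) (here refl) (there c₂∈) c₁<c₂ h =
  cong (D o ++_) (concatMap-single D os c₂ asc c₂∈ (λ x x∈ → h x (there x∈) (>⇒≢ (All.lookup o< x∈))))
concatMap-pair D (o ∷ os) c₁ c₂ (o< ∷ asc) (there c₁∈) (here refl) c₁<c₂ h = ⊥-elim (<-asym c₁<c₂ (All.lookup o< c₁∈))
concatMap-pair D (o ∷ os) c₁ c₂ (o< ∷ asc) (there c₁∈) (there c₂∈) c₁<c₂ h
  rewrite h o (here refl) (<⇒≢ (All.lookup o< c₁∈)) (<⇒≢ (All.lookup o< c₂∈)) =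
  concatMap-pair D os c₁ c₂ asc c₁∈ c₂∈ c₁<c₂ (λ x x∈ → h x (there x∈))

Decoration : Set
Decoration = ℕ → ℕ → List ℕ

noDecoration : Decoration
noDecoration _ _ = []

addDecoration : ℕ → ℕ → List ℕ → Decoration → Decoration
addDecoration c₀ y₀ L deco c y = if (c ≡ᵇ c₀) ∧ (y ≡ᵇ y₀) then L else deco c y

addDecoration-here : ∀ c y L deco → addDecoration c y L deco c y ≡ L
addDecoration-here c y L deco rewrite ≡ᵇ-refl c | ≡ᵇ-refl y = refl

addDecoration-elsewhere : ∀ c y L deco c′ y′ → (c′ ≡ c → y′ ≡ y → ⊥) → addDecoration c y L deco c′ y′ ≡ deco c′ y′
addDecoration-elsewhere c y L deco c′ y′ ne with c′ ≡ᵇ c in c′≡ᵇc | y′ ≡ᵇ y in y′≡ᵇy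
... | true  | true  = ⊥-elim (ne (≡ᵇ-true⇒≡ c′ c c′≡ᵇc) (≡ᵇ-true⇒≡ y′ y y′≡ᵇy))
... | true  | false = refl
... | false | _     = refl

addDecoration-node≢ : ∀ c y L deco c′ y′ → c′ ≢ c → addDecoration c y L deco c′ y′ ≡ deco c′ y′
addDecoration-node≢ c y L deco c′ y′ c′≢c = addDecoration-elsewhere c y L deco c′ y′ (λ e _ → c′≢c e)

addDecoration-slot≢ : ∀ c y L deco y′ → y′ ≢ y → addDecoration c y L deco c y′ ≡ deco c y′
addDecoration-slot≢ c y L deco y′ y′≢y = addDecoration-elsewhere c y L deco c y′ (λ _ e → y′≢y e)

AscendingDecoration : Decoration → Set
AscendingDecoration deco = ∀ o y → Ascending (deco o y) × All (o <_) (deco o y)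

noDecoration-ascending : AscendingDecoration noDecoration
noDecoration-ascending _ _ = [] , []

addDecoration-ascending : ∀ c y L deco → Ascending L → All (c <_) L → AscendingDecoration deco →
                          AscendingDecoration (addDecoration c y L deco)
addDecoration-ascending c y L deco ascL c<L asc o y′ with (o ≡ᵇ c) ∧ (y′ ≡ᵇ y) in e
... | false = asc o y′
... | true with ≡ᵇ-true⇒≡ o c (proj₁ (∧-true-split (o ≡ᵇ c) (y′ ≡ᵇ y) e))
...   | refl = ascL , c<L

module Combs (σ : ℕ → ℕ) where

  rightCombAddress : List ℕ → ℕ → List ℕ
  rightCombAddress [] b = []
  rightCombAddress (l ∷ L) b = if l ≡ᵇ b then [] else σ l ∷ rightCombAddress L b

  rightComb-at : ∀ L b → b ∈ L → At b (rightCombAddress L b) (rightComb σ L)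
  rightComb-at (l ∷ L) b b∈ with l ≡ᵇ b in l≡ᵇb
  ... | true rewrite ≡ᵇ-true⇒≡ l b l≡ᵇb = at-root
  ... | false = at-child (subst (λ x → AtL b x (rightCombAddress L b) (replicate (σ l) leaf ++ rightComb σ L ∷ []))
                                (length-replicate (σ l))
                                (AtL-last (replicate (σ l) leaf) (rightComb-at L b (∈-tail b∈ l≡ᵇb))))

  edgesRightOf-rightComb : ∀ L a b → a ∈ L → b ∈ L →
    edgesRightOf (rightCombAddress L a) (rightCombAddress L b) (suc (σ a)) ≡ 0
  edgesRightOf-rightComb (l ∷ L) a b a∈ b∈ with l ≡ᵇ a in l≡ᵇa | l ≡ᵇ b in l≡ᵇb
  ... | true  | true  = refl
  ... | true  | false rewrite ≡ᵇ-true⇒≡ l a l≡ᵇa = n∸n≡0 (σ a)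
  ... | false | true  = refl
  ... | false | false rewrite edgesRightOf-same (σ l) (rightCombAddress L a) (rightCombAddress L b) (suc (σ a)) =
    edgesRightOf-rightComb L a b (∈-tail a∈ l≡ᵇa) (∈-tail b∈ l≡ᵇb)

  above-rightComb : ∀ k L → All (k <_) L → Above k (rightComb σ L)
  above-rightComb k [] _ = tt
  above-rightComb k (l ∷ L) (k<l ∷ _) = k<l

  WF-rightComb : ∀ L → Ascending L → WF σ (rightComb σ L)
  WF-rightComb [] _ = tt
  WF-rightComb (l ∷ L) (l< ∷ asc) =
    length-snoc (replicate (σ l) leaf) (rightComb σ L) (σ l) (length-replicate (σ l)) ,
    AboveL-++ l (replicate (σ l) leaf) _ (AboveL-leaves l (σ l)) (above-rightComb l L l< , tt) ,
    WFL-++ σ (replicate (σ l) leaf) _ (WFL-leaves σ (σ l)) (WF-rightComb L asc , tt)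

  labels-rightComb : ∀ L → labels (rightComb σ L) ≡ L
  labels-rightComb [] = refl
  labels-rightComb (l ∷ L)
    rewrite labelsL-++ (replicate (σ l) leaf) (rightComb σ L ∷ []) | labelsL-leaves (σ l) | labels-rightComb L =
    cong (l ∷_) (++-identityʳ L)

  -- The decorated comb on the spine os is the right comb on os in which, for
  -- 1 ≤ y ≤ σ o, the (y+1)-st edge of o from the right carries the right comb
  -- on deco o y.  T_∨(α) and its lower cover are decorated combs.
  module Decorated (deco : Decoration) where

    slots : ℕ → ℕ → List Tree
    slots o zero = []
    slots o (suc m) = rightComb σ (deco o (suc m)) ∷ slots o m

    decoratedComb : List ℕ → Tree
    decoratedComb [] = leaf
    decoratedComb (o ∷ os) = node o (slots o (σ o) ++ decoratedComb os ∷ [])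

    slotAddress : List ℕ → ℕ → ℕ → List ℕ → List ℕ
    slotAddress [] c y R = []
    slotAddress (o ∷ os) c y R = if o ≡ᵇ c then (σ o ∸ y) ∷ R else σ o ∷ slotAddress os c y R

    length-slots : ∀ o m → length (slots o m) ≡ m
    length-slots o zero = refl
    length-slots o (suc m) = cong suc (length-slots o m)

    slots-at : ∀ o m y {b p} → 1 ≤ y → y ≤ m → At b p (rightComb σ (deco o y)) → ∀ Z →
               AtL b (m ∸ y) p (slots o m ++ Z)
    slots-at o zero (suc y) _ () _ _
    slots-at o (suc m) y {b} {p} 1≤y y≤1+m a Z with y ≟ suc m
    ... | yes refl rewrite n∸n≡0 m = at-here a
    ... | no y≢1+m with ≤-pred (≤∧≢⇒< y≤1+m y≢1+m)
    ...   | y≤m rewrite +-∸-assoc 1 y≤m = at-there (slots-at o m y 1≤y y≤m a Z)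

    spine-at : ∀ os b → b ∈ os → At b (rightCombAddress os b) (decoratedComb os)
    spine-at (o ∷ os) b b∈ with o ≡ᵇ b in o≡ᵇb
    ... | true rewrite ≡ᵇ-true⇒≡ o b o≡ᵇb = at-root
    ... | false = at-child (subst (λ x → AtL b x (rightCombAddress os b) (slots o (σ o) ++ decoratedComb os ∷ []))
                                  (length-slots o (σ o))
                                  (AtL-last (slots o (σ o)) (spine-at os b (∈-tail b∈ o≡ᵇb))))

    slot-at : ∀ os c y b → c ∈ os → 1 ≤ y → y ≤ σ c → b ∈ deco c y →
              At b (slotAddress os c y (rightCombAddress (deco c y) b)) (decoratedComb os)
    slot-at (o ∷ os) c y b c∈ 1≤y y≤σc b∈ with o ≡ᵇ c in o≡ᵇc
    ... | true rewrite ≡ᵇ-true⇒≡ o c o≡ᵇc = at-child (slots-at c (σ c) y 1≤y y≤σc (rightComb-at (deco c y) b b∈) _)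
    ... | false = at-child (subst (λ x → AtL b x (slotAddress os c y (rightCombAddress (deco c y) b))
                                               (slots o (σ o) ++ decoratedComb os ∷ []))
                                  (length-slots o (σ o))
                                  (AtL-last (slots o (σ o)) (slot-at os c y b (∈-tail c∈ o≡ᵇc) 1≤y y≤σc b∈)))

    edgesRightOf-slot-spine : ∀ os c y R b → c ∈ os → 1 ≤ y → y ≤ σ c → ∀ d →
      edgesRightOf (slotAddress os c y R) (rightCombAddress os b) d ≡ 0
    edgesRightOf-slot-spine (o ∷ os) c y R b c∈ 1≤y y≤σc d with o ≡ᵇ c in o≡ᵇc | o ≡ᵇ b in o≡ᵇb
    ... | true  | true  = refl
    ... | true  | false rewrite ≡ᵇ-true⇒≡ o c o≡ᵇc = edgesRightOf-< R _ d (∸-monoʳ-< 1≤y y≤σc)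
    ... | false | true  = refl
    ... | false | false rewrite edgesRightOf-same (σ o) (slotAddress os c y R) (rightCombAddress os b) d =
      edgesRightOf-slot-spine os c y R b (∈-tail c∈ o≡ᵇc) 1≤y y≤σc d

    edgesRightOf-spine-ownSlot : ∀ os c y R → c ∈ os → y ≤ σ c →
      edgesRightOf (rightCombAddress os c) (slotAddress os c y R) (suc (σ c)) ≡ y
    edgesRightOf-spine-ownSlot (o ∷ os) c y R c∈ y≤σc with o ≡ᵇ c in o≡ᵇc
    ... | true rewrite ≡ᵇ-true⇒≡ o c o≡ᵇc = m∸[m∸n]≡n y≤σc
    ... | false rewrite edgesRightOf-same (σ o) (rightCombAddress os c) (slotAddress os c y R) (suc (σ c)) =
      edgesRightOf-spine-ownSlot os c y R (∈-tail c∈ o≡ᵇc) y≤σc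

    edgesRightOf-spine-laterSlot : ∀ os a c y R → Ascending os → a ∈ os → c ∈ os → a < c →
      edgesRightOf (rightCombAddress os a) (slotAddress os c y R) (suc (σ a)) ≡ 0
    edgesRightOf-spine-laterSlot (o ∷ os) a c y R (o< ∷ asc) a∈ c∈ a<c with o ≡ᵇ a in o≡ᵇa | o ≡ᵇ c in o≡ᵇc
    ... | true  | true  rewrite ≡ᵇ-true⇒≡ o a o≡ᵇa | ≡ᵇ-true⇒≡ a c o≡ᵇc = ⊥-elim (<-irrefl refl a<c)
    ... | true  | false rewrite ≡ᵇ-true⇒≡ o a o≡ᵇa = n∸n≡0 (σ a)
    ... | false | true  rewrite ≡ᵇ-true⇒≡ o c o≡ᵇc = ⊥-elim (<-asym a<c (All.lookup o< (∈-tail a∈ o≡ᵇa)))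
    ... | false | false rewrite edgesRightOf-same (σ o) (rightCombAddress os a) (slotAddress os c y R) (suc (σ a)) =
      edgesRightOf-spine-laterSlot os a c y R asc (∈-tail a∈ o≡ᵇa) (∈-tail c∈ o≡ᵇc) a<c

    edgesRightOf-spine-earlierSlot : ∀ os a c y R → Ascending os → a ∈ os → c ∈ os → c < a →
      1 ≤ y → y ≤ σ c → ∀ d → edgesRightOf (rightCombAddress os a) (slotAddress os c y R) d ≡ d
    edgesRightOf-spine-earlierSlot (o ∷ os) a c y R (o< ∷ asc) a∈ c∈ c<a 1≤y y≤σc d
      with o ≡ᵇ a in o≡ᵇa | o ≡ᵇ c in o≡ᵇc
    ... | true  | true  rewrite ≡ᵇ-true⇒≡ o a o≡ᵇa | ≡ᵇ-true⇒≡ a c o≡ᵇc = ⊥-elim (<-irrefl refl c<a)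
    ... | true  | false rewrite ≡ᵇ-true⇒≡ o a o≡ᵇa = ⊥-elim (<-asym c<a (All.lookup o< (∈-tail c∈ o≡ᵇc)))
    ... | false | true  rewrite ≡ᵇ-true⇒≡ o c o≡ᵇc =
      edgesRightOf-> (rightCombAddress os a) R d (∸-monoʳ-< 1≤y y≤σc)
    ... | false | false rewrite edgesRightOf-same (σ o) (rightCombAddress os a) (slotAddress os c y R) d =
      edgesRightOf-spine-earlierSlot os a c y R asc (∈-tail a∈ o≡ᵇa) (∈-tail c∈ o≡ᵇc) c<a 1≤y y≤σc d

    edgesRightOf-slot-laterSlot : ∀ os c′ y′ R′ c y R → Ascending os → c′ ∈ os → c ∈ os → c′ < c →
      1 ≤ y′ → y′ ≤ σ c′ → ∀ d → edgesRightOf (slotAddress os c′ y′ R′) (slotAddress os c y R) d ≡ 0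
    edgesRightOf-slot-laterSlot (o ∷ os) c′ y′ R′ c y R (o< ∷ asc) c′∈ c∈ c′<c 1≤y′ y′≤σc′ d
      with o ≡ᵇ c′ in o≡ᵇc′ | o ≡ᵇ c in o≡ᵇc
    ... | true  | true  rewrite ≡ᵇ-true⇒≡ o c′ o≡ᵇc′ | ≡ᵇ-true⇒≡ c′ c o≡ᵇc = ⊥-elim (<-irrefl refl c′<c)
    ... | true  | false rewrite ≡ᵇ-true⇒≡ o c′ o≡ᵇc′ = edgesRightOf-< R′ _ d (∸-monoʳ-< 1≤y′ y′≤σc′)
    ... | false | true  rewrite ≡ᵇ-true⇒≡ o c o≡ᵇc = ⊥-elim (<-asym c′<c (All.lookup o< (∈-tail c′∈ o≡ᵇc′)))
    ... | false | false rewrite edgesRightOf-same (σ o) (slotAddress os c′ y′ R′) (slotAddress os c y R) d =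
      edgesRightOf-slot-laterSlot os c′ y′ R′ c y R asc (∈-tail c′∈ o≡ᵇc′) (∈-tail c∈ o≡ᵇc) c′<c 1≤y′ y′≤σc′ d

    edgesRightOf-sameNode : ∀ os c y′ R′ y R → c ∈ os → ∀ d →
      edgesRightOf (slotAddress os c y′ R′) (slotAddress os c y R) d ≡ edgesRightOf ((σ c ∸ y′) ∷ R′) ((σ c ∸ y) ∷ R) d
    edgesRightOf-sameNode (o ∷ os) c y′ R′ y R c∈ d with o ≡ᵇ c in o≡ᵇc
    ... | true rewrite ≡ᵇ-true⇒≡ o c o≡ᵇc = refl
    ... | false rewrite edgesRightOf-same (σ o) (slotAddress os c y′ R′) (slotAddress os c y R) d =
      edgesRightOf-sameNode os c y′ R′ y R (∈-tail c∈ o≡ᵇc) d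

    decorations : ℕ → ℕ → List ℕ
    decorations o zero = []
    decorations o (suc m) = deco o (suc m) ++ decorations o m

    allDecorations : List ℕ → List ℕ
    allDecorations = concatMap (λ o → decorations o (σ o))

    module _ (asc-deco : AscendingDecoration deco) where

      AboveL-slots : ∀ o m → AboveL o (slots o m)
      AboveL-slots o zero = tt
      AboveL-slots o (suc m) = above-rightComb o _ (proj₂ (asc-deco o (suc m))) , AboveL-slots o m

      WFL-slots : ∀ o m → WFL σ (slots o m)
      WFL-slots o zero = tt
      WFL-slots o (suc m) = WF-rightComb _ (proj₁ (asc-deco o (suc m))) , WFL-slots o m

      above-decoratedComb : ∀ k os → All (k <_) os → Above k (decoratedComb os)
      above-decoratedComb k [] _ = tt
      above-decoratedComb k (o ∷ os) (k<o ∷ _) = k<o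

      WF-decoratedComb : ∀ os → Ascending os → WF σ (decoratedComb os)
      WF-decoratedComb [] _ = tt
      WF-decoratedComb (o ∷ os) (o< ∷ asc) =
        length-snoc (slots o (σ o)) (decoratedComb os) (σ o) (length-slots o (σ o)) ,
        AboveL-++ o (slots o (σ o)) _ (AboveL-slots o (σ o)) (above-decoratedComb o os o< , tt) ,
        WFL-++ σ (slots o (σ o)) _ (WFL-slots o (σ o)) (WF-decoratedComb os asc , tt)

    labelsL-slots : ∀ o m → labelsL (slots o m) ≡ decorations o m
    labelsL-slots o zero = refl
    labelsL-slots o (suc m) rewrite labels-rightComb (deco o (suc m)) | labelsL-slots o m = refl

    labels-decoratedComb : ∀ os → labels (decoratedComb os) ↭ os ++ allDecorations os
    labels-decoratedComb [] = ↭-refl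
    labels-decoratedComb (o ∷ os)
      rewrite labelsL-++ (slots o (σ o)) (decoratedComb os ∷ []) | labelsL-slots o (σ o)
            | ++-identityʳ (labels (decoratedComb os)) =
      prep o (↭-trans (++⁺ˡ (decorations o (σ o)) (labels-decoratedComb os)) (shifts (decorations o (σ o)) os))

    slots-undecorated : ∀ o m → (∀ y → y ≤ m → deco o y ≡ []) → slots o m ≡ replicate m leaf
    slots-undecorated o zero h = refl
    slots-undecorated o (suc m) h rewrite h (suc m) ≤-refl =
      cong (leaf ∷_) (slots-undecorated o m (λ y y≤m → h y (m≤n⇒m≤1+n y≤m)))

    decorations-none : ∀ o m → (∀ y → y ≤ m → deco o y ≡ []) → decorations o m ≡ []
    decorations-none o zero h = refl
    decorations-none o (suc m) h rewrite h (suc m) ≤-refl =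
      decorations-none o m (λ y y≤m → h y (m≤n⇒m≤1+n y≤m))

    decorations-single : ∀ o m r → 1 ≤ r → r ≤ m → (∀ y → y ≤ m → y ≢ r → deco o y ≡ []) →
                         decorations o m ≡ deco o r
    decorations-single o zero (suc r) _ () _
    decorations-single o (suc m) r 1≤r r≤1+m h with suc m ≟ r
    ... | yes refl = trans (cong (deco o (suc m) ++_)
                             (decorations-none o m (λ y y≤m → h y (m≤n⇒m≤1+n y≤m) (<⇒≢ (s≤s y≤m)))))
                           (++-identityʳ _)
    ... | no 1+m≢r rewrite h (suc m) ≤-refl 1+m≢r =
      decorations-single o m r 1≤r (≤-pred (≤∧≢⇒< r≤1+m (≢-sym 1+m≢r))) (λ y y≤m → h y (m≤n⇒m≤1+n y≤m))

    decorations-pair : ∀ o m r₁ r₂ → 1 ≤ r₂ → r₂ < r₁ → r₁ ≤ m →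
                       (∀ y → y ≤ m → y ≢ r₁ → y ≢ r₂ → deco o y ≡ []) →
                       decorations o m ≡ deco o r₁ ++ deco o r₂
    decorations-pair o zero (suc r₁) r₂ _ _ () _
    decorations-pair o (suc m) r₁ r₂ 1≤r₂ r₂<r₁ r₁≤1+m h with suc m ≟ r₁
    ... | yes refl = cong (deco o (suc m) ++_)
      (decorations-single o m r₂ 1≤r₂ (≤-pred r₂<r₁) (λ y y≤m → h y (m≤n⇒m≤1+n y≤m) (<⇒≢ (s≤s y≤m))))
    ... | no 1+m≢r₁ rewrite h (suc m) ≤-refl 1+m≢r₁ (>⇒≢ (<-≤-trans r₂<r₁ r₁≤1+m)) =
      decorations-pair o m r₁ r₂ 1≤r₂ r₂<r₁ (≤-pred (≤∧≢⇒< r₁≤1+m (≢-sym 1+m≢r₁))) (λ y y≤m → h y (m≤n⇒m≤1+n y≤m))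

    decoratedComb-undecorated : ∀ os → All (λ o → ∀ y → deco o y ≡ []) os → decoratedComb os ≡ rightComb σ os
    decoratedComb-undecorated [] _ = refl
    decoratedComb-undecorated (o ∷ os) (h ∷ hs)
      rewrite slots-undecorated o (σ o) (λ y _ → h y) | decoratedComb-undecorated os hs = refl

    setAt-slots : ∀ i r I Z m → 1 ≤ r → r ≤ m → deco i r ≡ I → (∀ y → y ≢ r → deco i y ≡ []) →
                  setAt (m ∸ r) (rightComb σ I) (replicate m leaf ++ Z) ≡ slots i m ++ Z
    setAt-slots i (suc r) I Z zero _ () _ _
    setAt-slots i r I Z (suc m) 1≤r r≤1+m e h with suc m ≟ r
    ... | yes refl rewrite n∸n≡0 m | e | slots-undecorated i m (λ y y≤m → h y (<⇒≢ (s≤s y≤m))) = refl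
    ... | no 1+m≢r with ≤-pred (≤∧≢⇒< r≤1+m (≢-sym 1+m≢r))
    ...   | r≤m rewrite +-∸-assoc 1 r≤m | h (suc m) 1+m≢r = cong (leaf ∷_) (setAt-slots i r I Z m 1≤r r≤m e h)

  graft-rightComb : ∀ i r I O → Ascending O → i ∈ O → 1 ≤ r → r ≤ σ i →
    graft i r (rightComb σ I) (rightComb σ O) ≡ Decorated.decoratedComb (addDecoration i r I noDecoration) O
  graft-rightComb i r I (o ∷ O) (o< ∷ asc) i∈ 1≤r r≤σi with o ≡ᵇ i in o≡ᵇi
  ... | true with ≡ᵇ-true⇒≡ o i o≡ᵇi
  ...   | refl = cong (node o) (begin
      setAt (length (replicate (σ o) leaf ++ rightComb σ O ∷ []) ∸ suc r) (rightComb σ I)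
            (replicate (σ o) leaf ++ rightComb σ O ∷ [])
        ≡⟨ cong (λ L → setAt (L ∸ suc r) (rightComb σ I) (replicate (σ o) leaf ++ rightComb σ O ∷ []))
                (length-snoc (replicate (σ o) leaf) (rightComb σ O) (σ o) (length-replicate (σ o))) ⟩
      setAt (σ o ∸ r) (rightComb σ I) (replicate (σ o) leaf ++ rightComb σ O ∷ [])
        ≡⟨ setAt-slots o r I (rightComb σ O ∷ []) (σ o) 1≤r r≤σi (addDecoration-here o r I noDecoration)
                       (addDecoration-slot≢ o r I noDecoration) ⟩
      slots o (σ o) ++ rightComb σ O ∷ []
        ≡⟨ cong (λ t → slots o (σ o) ++ t ∷ [])
                (decoratedComb-undecorated O (All.map (λ o<x y → addDecoration-node≢ o r I noDecoration _ y (>⇒≢ o<x)) o<)) ⟨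
      slots o (σ o) ++ decoratedComb O ∷ [] ∎)
    where
    open ≡-Reasoning
    open Decorated (addDecoration o r I noDecoration)
  graft-rightComb i r I (o ∷ O) (o< ∷ asc) i∈ 1≤r r≤σi | false
    rewrite graftL-leaves i r (rightComb σ I) (σ o) (rightComb σ O ∷ [])
          | Decorated.slots-undecorated (addDecoration i r I noDecoration) o (σ o)
              (λ y _ → addDecoration-node≢ i r I noDecoration o y (≡ᵇ-false⇒≢ o i o≡ᵇi))
          | graft-rightComb i r I O asc (∈-tail i∈ o≡ᵇi) 1≤r r≤σi = refl

fromTo : ℕ → ℕ → List ℕ
fromTo k zero = []
fromTo k (suc m) = k ∷ fromTo (suc k) m

filterBy : (ℕ → Bool) → List ℕ → List ℕ
filterBy P [] = []
filterBy P (x ∷ xs) = if P x then x ∷ filterBy P xs else filterBy P xs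

applyUpTo-fromTo : ∀ (f : ℕ → ℕ) k m → (∀ x → f x ≡ k + x) → applyUpTo f m ≡ fromTo k m
applyUpTo-fromTo f k zero _ = refl
applyUpTo-fromTo f k (suc m) h =
  cong₂ _∷_ (trans (h 0) (+-identityʳ k)) (applyUpTo-fromTo (λ x → f (suc x)) (suc k) m (λ x → trans (h (suc x)) (+-suc k x)))

tabulate-fromTo : ∀ k m (f : Fin m → ℕ) → (∀ x → f x ≡ k + toℕ x) → tabulate f ≡ fromTo k m
tabulate-fromTo k zero f _ = refl
tabulate-fromTo k (suc m) f h =
  cong₂ _∷_ (trans (h fzero) (+-identityʳ k)) (tabulate-fromTo (suc k) m (λ x → f (fsuc x)) (λ x → trans (h (fsuc x)) (+-suc k (toℕ x))))

map-suc-upTo : ∀ n → map suc (upTo n) ≡ fromTo 1 n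
map-suc-upTo n = trans (map-applyUpTo id suc n) (applyUpTo-fromTo suc 1 n (λ _ → refl))

filterᵇ-map : ∀ {m} (p : Fin m → Bool) (P : ℕ → Bool) (g : Fin m → ℕ) → (∀ f → p f ≡ P (g f)) →
              ∀ xs → map g (filterᵇ p xs) ≡ filterBy P (map g xs)
filterᵇ-map p P g h [] = refl
filterᵇ-map p P g h (x ∷ xs) with p x in e
... | true  rewrite sym (h x) | e = cong (g x ∷_) (filterᵇ-map p P g h xs)
... | false rewrite sym (h x) | e = filterᵇ-map p P g h xs

labelsWhere-filterBy : ∀ n (p : Fin n → Bool) (P : ℕ → Bool) → (∀ f → p f ≡ P (suc (toℕ f))) →
                       labelsWhere n p ≡ filterBy P (fromTo 1 n)
labelsWhere-filterBy n p P h =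
  trans (filterᵇ-map p P (λ f → suc (toℕ f)) h (allFin n))
        (cong (filterBy P) (trans (map-tabulate id (λ f → suc (toℕ f))) (tabulate-fromTo 1 n _ (λ _ → refl))))

∈-fromTo⁻ : ∀ {b} k m → b ∈ fromTo k m → k ≤ b × b < k + m
∈-fromTo⁻ k (suc m) (here refl) = ≤-refl , subst (k <_) (sym (+-suc k m)) (s≤s (m≤m+n k m))
∈-fromTo⁻ {b} k (suc m) (there b∈) with ∈-fromTo⁻ (suc k) m b∈
... | k<b , b<k+m = <⇒≤ k<b , subst (b <_) (sym (+-suc k m)) b<k+m

∈-fromTo⁺ : ∀ {b} k m → k ≤ b → b < k + m → b ∈ fromTo k m
∈-fromTo⁺ {b} k zero k≤b b<k = ⊥-elim (<⇒≱ b<k (≤-trans (≤-reflexive (+-identityʳ k)) k≤b))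
∈-fromTo⁺ {b} k (suc m) k≤b b<k+m with k ≟ b
... | yes refl = here refl
... | no k≢b = there (∈-fromTo⁺ (suc k) m (≤∧≢⇒< k≤b k≢b) (subst (b <_) (+-suc k m) b<k+m))

fromTo-ascending : ∀ k m → Ascending (fromTo k m)
fromTo-ascending k zero = []
fromTo-ascending k (suc m) = All.tabulate (λ b∈ → proj₁ (∈-fromTo⁻ (suc k) m b∈)) ∷ fromTo-ascending (suc k) m

∈-filterBy⁻ : ∀ {b} P xs → b ∈ filterBy P xs → b ∈ xs × P b ≡ true
∈-filterBy⁻ P (x ∷ xs) b∈ with P x in Px
∈-filterBy⁻ P (x ∷ xs) (here refl) | true = here refl , Px
∈-filterBy⁻ P (x ∷ xs) (there b∈)  | true = Product.map₁ there (∈-filterBy⁻ P xs b∈)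
∈-filterBy⁻ P (x ∷ xs) b∈          | false = Product.map₁ there (∈-filterBy⁻ P xs b∈)

∈-filterBy⁺ : ∀ {b} P xs → b ∈ xs → P b ≡ true → b ∈ filterBy P xs
∈-filterBy⁺ P (x ∷ xs) (here refl) Pb rewrite Pb = here refl
∈-filterBy⁺ P (x ∷ xs) (there b∈) Pb with P x
... | true  = there (∈-filterBy⁺ P xs b∈ Pb)
... | false = ∈-filterBy⁺ P xs b∈ Pb

filterBy-ascending : ∀ P xs → Ascending xs → Ascending (filterBy P xs)
filterBy-ascending P [] _ = []
filterBy-ascending P (x ∷ xs) (x< ∷ asc) with P x
... | true  = All.tabulate (λ b∈ → All.lookup x< (proj₁ (∈-filterBy⁻ P xs b∈))) ∷ filterBy-ascending P xs asc
... | false = filterBy-ascending P xs asc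

ascending⇒unique : ∀ {xs} → Ascending xs → Unique xs
ascending⇒unique = AllPairs.map <⇒≢

filterBy-partition : ∀ P xs → filterBy (λ b → not (P b)) xs ++ filterBy P xs ↭ xs
filterBy-partition P [] = ↭-refl
filterBy-partition P (x ∷ xs) with P x
... | true  = ↭-trans (shift x (filterBy (λ b → not (P b)) xs) (filterBy P xs)) (prep x (filterBy-partition P xs))
... | false = prep x (filterBy-partition P xs)

unique-same-elements⇒↭ : ∀ {xs ys : List ℕ} → Unique xs → Unique ys →
                         (∀ {b} → b ∈ xs → b ∈ ys) → (∀ {b} → b ∈ ys → b ∈ xs) → xs ↭ ys
unique-same-elements⇒↭ ux uy f g = ∼bag⇒↭ (unique∧set⇒bag ux uy (mk⇔ f g))

mutual
  occurs⇒∈labels : ∀ b t → occurs b t ≡ true → b ∈ labels t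
  occurs⇒∈labels b (node k cs) e with ∨-true-split (k ≡ᵇ b) (occursL b cs) e
  ... | inj₁ e₁ = here (sym (≡ᵇ-true⇒≡ k b e₁))
  ... | inj₂ e₂ = there (occursL⇒∈labelsL b cs e₂)

  occursL⇒∈labelsL : ∀ b cs → occursL b cs ≡ true → b ∈ labelsL cs
  occursL⇒∈labelsL b (c ∷ cs) e with ∨-true-split (occurs b c) (occursL b cs) e
  ... | inj₁ e₁ = ∈-++⁺ˡ (occurs⇒∈labels b c e₁)
  ... | inj₂ e₂ = ∈-++⁺ʳ (labels c) (occursL⇒∈labelsL b cs e₂)

mutual
  ∈labels⇒occurs : ∀ b t → b ∈ labels t → occurs b t ≡ true
  ∈labels⇒occurs b (node k cs) (here refl) = occurs-root b cs
  ∈labels⇒occurs b (node k cs) (there b∈) = occurs-child k b cs (∈labelsL⇒occursL b cs b∈)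

  ∈labelsL⇒occursL : ∀ b cs → b ∈ labelsL cs → occursL b cs ≡ true
  ∈labelsL⇒occursL b (c ∷ cs) b∈ with ∈-++⁻ (labels c) b∈
  ... | inj₁ b∈c  = occursL-here b c cs (∈labels⇒occurs b c b∈c)
  ... | inj₂ b∈cs = occursL-there b c cs (∈labelsL⇒occursL b cs b∈cs)

Unique-++⁻ : ∀ (xs ys : List ℕ) → Unique (xs ++ ys) → Unique xs × Unique ys × (∀ {b} → b ∈ xs → b ∉ ys)
Unique-++⁻ [] ys u = [] , u , λ ()
Unique-++⁻ (x ∷ xs) ys (x∉ ∷ u) with Unique-++⁻ xs ys u
... | u₁ , u₂ , disj = (All++⁻ˡ xs x∉ ∷ u₁) , u₂ ,
  λ { (here refl) b∈ys → All.lookup (All++⁻ʳ xs x∉) b∈ys refl ; (there b∈xs) → disj b∈xs }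

mutual
  unique⇒distinctLabels : ∀ t → Unique (labels t) → DistinctLabels t
  unique⇒distinctLabels leaf _ = tt
  unique⇒distinctLabels (node k cs) (k∉ ∷ u) =
    ¬-not (λ e → All.lookup k∉ (occursL⇒∈labelsL k cs e) refl) , unique⇒distinctLabelsL cs u

  unique⇒distinctLabelsL : ∀ cs → Unique (labelsL cs) → DistinctLabelsL cs
  unique⇒distinctLabelsL [] _ = tt
  unique⇒distinctLabelsL (c ∷ cs) u with Unique-++⁻ (labels c) (labelsL cs) u
  ... | u₁ , u₂ , disj = unique⇒distinctLabels c u₁ , unique⇒distinctLabelsL cs u₂ ,
        λ b e → ¬-not (λ e′ → disj (occurs⇒∈labels b c e) (occursL⇒∈labelsL b cs e′))

module STrees (n : ℕ) (s : Vec ℕ n) where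

  labels↭fromTo : ∀ {t} → IsSTree n s t → labels t ↭ fromTo 1 n
  labels↭fromTo {t} st = subst (labels t ↭_) (map-suc-upTo n) (proj₁ st)

  mkSTree : ∀ {t} → labels t ↭ fromTo 1 n → WF (sAt s) t → IsSTree n s t
  mkSTree {t} p w = subst (labels t ↭_) (sym (map-suc-upTo n)) p , w

  sTree-distinct : ∀ {t} → IsSTree n s t → DistinctLabels t
  sTree-distinct {t} st =
    unique⇒distinctLabels t (Unique-resp-↭ (↭⇒↭ₛ (↭-sym (labels↭fromTo st))) (ascending⇒unique (fromTo-ascending 1 n)))

  sTree-occurs⁻ : ∀ {t} → IsSTree n s t → ∀ b → occurs b t ≡ true → 1 ≤ b × b ≤ n
  sTree-occurs⁻ {t} st b e = Product.map₂ ≤-pred (∈-fromTo⁻ 1 n (∈-resp-↭ (labels↭fromTo st) (occurs⇒∈labels b t e)))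

  sTree-occurs⁺ : ∀ {t} → IsSTree n s t → ∀ b → 1 ≤ b → b ≤ n → occurs b t ≡ true
  sTree-occurs⁺ {t} st b 1≤b b≤n = ∈labels⇒occurs b t (∈-resp-↭ (↭-sym (labels↭fromTo st)) (∈-fromTo⁺ 1 n 1≤b (s≤s b≤n)))

-- The s-weak order

mutual
  tree-≟ : (t u : Tree) → Dec (t ≡ u)
  tree-≟ leaf leaf = yes refl
  tree-≟ leaf (node _ _) = no (λ ())
  tree-≟ (node _ _) leaf = no (λ ())
  tree-≟ (node k cs) (node k′ cs′) with k ≟ k′ | trees-≟ cs cs′
  ... | yes refl | yes refl = yes refl
  ... | no k≢k′  | _        = no (λ { refl → k≢k′ refl })
  ... | yes _    | no cs≢cs′ = no (λ { refl → cs≢cs′ refl })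

  trees-≟ : (cs ds : List Tree) → Dec (cs ≡ ds)
  trees-≟ [] [] = yes refl
  trees-≟ [] (_ ∷ _) = no (λ ())
  trees-≟ (_ ∷ _) [] = no (λ ())
  trees-≟ (c ∷ cs) (d ∷ ds) with tree-≟ c d | trees-≟ cs ds
  ... | yes refl | yes refl = yes refl
  ... | no c≢d   | _        = no (λ { refl → c≢d refl })
  ... | yes _    | no cs≢ds = no (λ { refl → cs≢ds refl })

sumOver : (ℕ → ℕ) → List ℕ → ℕ
sumOver f [] = 0
sumOver f (x ∷ xs) = f x + sumOver f xs

sumOver-mono : ∀ f g xs → (∀ {x} → x ∈ xs → f x ≤ g x) → sumOver f xs ≤ sumOver g xs
sumOver-mono f g [] h = z≤n
sumOver-mono f g (x ∷ xs) h = +-mono-≤ (h (here refl)) (sumOver-mono f g xs (h ∘ there))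

sumOver-≡⇒≡ : ∀ f g xs → (∀ {x} → x ∈ xs → f x ≤ g x) → sumOver f xs ≡ sumOver g xs →
              ∀ {x} → x ∈ xs → f x ≡ g x
sumOver-≡⇒≡ f g (x ∷ xs) h e y∈ with m≤n⇒m<n∨m≡n (h (here refl))
... | inj₁ fx<gx = ⊥-elim (<-irrefl e (+-mono-<-≤ fx<gx (sumOver-mono f g xs (h ∘ there))))
sumOver-≡⇒≡ f g (x ∷ xs) h e (here refl) | inj₂ fx≡gx = fx≡gx
sumOver-≡⇒≡ f g (x ∷ xs) h e (there y∈) | inj₂ fx≡gx =
  sumOver-≡⇒≡ f g xs (h ∘ there) (+-cancelˡ-≡ (f x) _ _ (trans e (cong (_+ _) (sym fx≡gx)))) y∈

sumOver-<⇒∃ : ∀ f g xs → sumOver f xs < sumOver g xs → ∃ λ x → x ∈ xs × f x < g x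
sumOver-<⇒∃ f g (x ∷ xs) lt with f x <? g x
... | yes fx<gx = x , here refl , fx<gx
... | no fx≮gx with sumOver-<⇒∃ f g xs (+-cancelˡ-< (f x) _ _ (<-≤-trans lt (+-monoˡ-≤ _ (≮⇒≥ fx≮gx))))
...   | y , y∈ , fy<gy = y , there y∈ , fy<gy

module WeakOrder (n : ℕ) (s : Vec ℕ n) where
  open STrees n s
  open WellFormed (sAt s)

  ≤[]-refl : ∀ t → t ≤[ s ] t
  ≤[]-refl t _ _ _ _ _ = ≤-refl

  ≤[]-trans : ∀ {t u v} → t ≤[ s ] u → u ≤[ s ] v → t ≤[ s ] v
  ≤[]-trans p q i j 1≤i i<j j≤n = ≤-trans (p i j 1≤i i<j j≤n) (q i j 1≤i i<j j≤n)

  ≤[]-antisym : ∀ {t u} → IsSTree n s t → IsSTree n s u → t ≤[ s ] u → u ≤[ s ] t → t ≡ u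
  ≤[]-antisym {t} {u} st su p q =
    pos-determines-tree t u (proj₂ st) (proj₂ su) (sTree-distinct st) (sTree-distinct su)
      (λ b → Bool-≡-from-⇔ (λ e → let (1≤b , b≤n) = sTree-occurs⁻ st b e in sTree-occurs⁺ su b 1≤b b≤n)
                           (λ e → let (1≤b , b≤n) = sTree-occurs⁻ su b e in sTree-occurs⁺ st b 1≤b b≤n))
      (λ a b a<b ea eb → let 1≤a = proj₁ (sTree-occurs⁻ st a ea); b≤n = proj₂ (sTree-occurs⁻ st b eb)
                         in ≤-antisym (p a b 1≤a a<b b≤n) (q a b 1≤a a<b b≤n))

  pos-planarity : ∀ V → IsSTree n s V → ∀ a b c → 1 ≤ a → a < b → b < c → c ≤ n →
                  pos s V a b < pos s V a c → pos s V b c ≡ sAt s b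
  pos-planarity V sV a b c 1≤a a<b b<c c≤n lt =
    m≤n⇒m⊓n≡m (planarity a b c V (proj₂ sV) (sTree-distinct sV) a<b b<c
      (sTree-occurs⁺ sV a 1≤a (≤-trans (<⇒≤ a<b) (≤-trans (<⇒≤ b<c) c≤n)))
      (sTree-occurs⁺ sV b (≤-trans 1≤a (<⇒≤ a<b)) (≤-trans (<⇒≤ b<c) c≤n))
      (sTree-occurs⁺ sV c (≤-trans 1≤a (<⇒≤ (<-trans a<b b<c))) c≤n) lt)

  joinIrreducible-criterion : ∀ {T u} i j → IsSTree n s T → IsSTree n s u →
    u ≤[ s ] T → pos s u i j < pos s T i j →
    (∀ v → IsSTree n s v → v ≤[ s ] T → pos s v i j < pos s T i j → v ≤[ s ] u) →
    (∀ v → IsSTree n s v → v ≤[ s ] T → pos s T i j ≤ pos s v i j → T ≤[ s ] v) →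
    JoinIrreducible n s T
  joinIrreducible-criterion {T} {u} i j sT su u≤T u<T below above = u , (su , cover) , unique
    where
    u≢T : u ≢ T
    u≢T refl = <-irrefl refl u<T
    between : ∀ w → IsSTree n s w → u ≤[ s ] w → w ≤[ s ] T → w ≡ u ⊎ w ≡ T
    between w sw u≤w w≤T with pos s w i j <? pos s T i j
    ... | yes lt = inj₁ (≤[]-antisym sw su (below w sw w≤T lt) u≤w)
    ... | no ≮  = inj₂ (≤[]-antisym sw sT w≤T (above w sw w≤T (≮⇒≥ ≮)))
    cover : Covers n s T u
    cover = u≤T , u≢T , between
    unique : ∀ v → IsSTree n s v → Covers n s T v → v ≡ u
    unique v sv (v≤T , v≢T , between-v) with pos s v i j <? pos s T i j
    ... | no ≮ = ⊥-elim (v≢T (≤[]-antisym sv sT v≤T (above v sv v≤T (≮⇒≥ ≮))))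
    ... | yes lt with between-v u su (below v sv v≤T lt) u≤T
    ...   | inj₁ u≡v = sym u≡v
    ...   | inj₂ u≡T = ⊥-elim (u≢T u≡T)

  -- The sum of all values of pos: strictly monotone, so it bounds the length of chains.
  posWhenOrdered : Tree → ℕ → ℕ → ℕ
  posWhenOrdered v a b = if a <ᵇ b then pos s v a b else 0

  weight : Tree → ℕ
  weight v = sumOver (λ a → sumOver (posWhenOrdered v a) (fromTo 1 n)) (fromTo 1 n)

  private
    ∈-labels⁺ : ∀ {a b} → 1 ≤ a → a < b → b ≤ n → a ∈ fromTo 1 n × b ∈ fromTo 1 n
    ∈-labels⁺ 1≤a a<b b≤n = ∈-fromTo⁺ 1 n 1≤a (s≤s (≤-trans (<⇒≤ a<b) b≤n)) ,
                            ∈-fromTo⁺ 1 n (≤-trans 1≤a (<⇒≤ a<b)) (s≤s b≤n)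

    ∈-labels⁻ : ∀ {a} → a ∈ fromTo 1 n → 1 ≤ a × a ≤ n
    ∈-labels⁻ a∈ = Product.map₂ ≤-pred (∈-fromTo⁻ 1 n a∈)

    posWhenOrdered-mono : ∀ v w → v ≤[ s ] w → ∀ {a b} → a ∈ fromTo 1 n → b ∈ fromTo 1 n →
                      posWhenOrdered v a b ≤ posWhenOrdered w a b
    posWhenOrdered-mono v w v≤w {a} {b} a∈ b∈ with a <ᵇ b in a<ᵇb
    ... | true  = v≤w a b (proj₁ (∈-labels⁻ a∈)) (<ᵇ-true⇒< a<ᵇb) (proj₂ (∈-labels⁻ b∈))
    ... | false = z≤n

    sum-mono : ∀ v w → v ≤[ s ] w → ∀ {a} → a ∈ fromTo 1 n →
               sumOver (posWhenOrdered v a) (fromTo 1 n) ≤ sumOver (posWhenOrdered w a) (fromTo 1 n)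
    sum-mono v w v≤w a∈ = sumOver-mono _ _ (fromTo 1 n) (posWhenOrdered-mono v w v≤w a∈)

  weight-mono : ∀ v w → v ≤[ s ] w → weight v ≤ weight w
  weight-mono v w v≤w = sumOver-mono _ _ (fromTo 1 n) (sum-mono v w v≤w)

  weight-≡⇒≥ : ∀ v w → v ≤[ s ] w → weight v ≡ weight w → w ≤[ s ] v
  weight-≡⇒≥ v w v≤w e a b 1≤a a<b b≤n = ≤-reflexive (sym (begin
      pos s v a b            ≡⟨ cong (if_then pos s v a b else 0) (<⇒<ᵇ-true a<b) ⟨
      posWhenOrdered v a b       ≡⟨ sumOver-≡⇒≡ _ _ (fromTo 1 n) (posWhenOrdered-mono v w v≤w a∈) inner b∈ ⟩
      posWhenOrdered w a b       ≡⟨ cong (if_then pos s w a b else 0) (<⇒<ᵇ-true a<b) ⟩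
      pos s w a b            ∎))
    where
    open ≡-Reasoning
    a∈ = proj₁ (∈-labels⁺ 1≤a a<b b≤n)
    b∈ = proj₂ (∈-labels⁺ 1≤a a<b b≤n)
    inner = sumOver-≡⇒≡ _ _ (fromTo 1 n) (sum-mono v w v≤w) e a∈

  weight-strict : ∀ {v w} → IsSTree n s v → IsSTree n s w → v ≤[ s ] w → v ≢ w → weight v < weight w
  weight-strict {v} {w} sv sw v≤w v≢w = ≤∧≢⇒< (weight-mono v w v≤w) (λ e → v≢w (≤[]-antisym sv sw v≤w (weight-≡⇒≥ v w v≤w e)))

  strictly-below⇒separating-pair : ∀ {u X} → IsSTree n s u → IsSTree n s X → u ≤[ s ] X → u ≢ X →
    ∃ λ i → ∃ λ j → 1 ≤ i × i < j × j ≤ n × pos s u i j < pos s X i j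
  strictly-below⇒separating-pair {u} {X} su sX u≤X u≢X
    with sumOver-<⇒∃ _ _ (fromTo 1 n) (weight-strict {u} {X} su sX u≤X u≢X)
  ... | a , a∈ , lt with sumOver-<⇒∃ _ _ (fromTo 1 n) lt
  ...   | b , b∈ , lt′ with a <ᵇ b in a<ᵇb
  ...     | true  = a , b , proj₁ (∈-labels⁻ a∈) , <ᵇ-true⇒< a<ᵇb , proj₂ (∈-labels⁻ b∈) , lt′
  ...     | false = ⊥-elim (<-irrefl refl lt′)

  module _ {T u : Tree} (sT : IsSTree n s T) (su : IsSTree n s u) (cover : Covers n s T u)
           (unique : ∀ v → IsSTree n s v → Covers n s T v → v ≡ u) where

    private
      below-by-slack : ∀ k v → IsSTree n s v → v ≤[ s ] T → v ≢ T → weight T ≤ weight v + k →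
                       ¬ ¬ (v ≤[ s ] u)
      below-by-slack zero v sv v≤T v≢T slack v≰u =
        <-irrefl refl (<-≤-trans (weight-strict {v} {T} sv sT v≤T v≢T) (subst (weight T ≤_) (+-identityʳ _) slack))
      below-by-slack (suc k) v sv v≤T v≢T slack v≰u = not-covered (v≤T , v≢T , between)
        where
        not-covered : ¬ Covers n s T v
        not-covered c with unique v sv c
        ... | refl = v≰u (≤[]-refl v)
        between : ∀ w → IsSTree n s w → v ≤[ s ] w → w ≤[ s ] T → w ≡ v ⊎ w ≡ T
        between w sw v≤w w≤T with tree-≟ w v | tree-≟ w T
        ... | yes w≡v | _       = inj₁ w≡v
        ... | no _    | yes w≡T = inj₂ w≡T
        ... | no w≢v  | no w≢T  =
          ⊥-elim (below-by-slack k w sw w≤T w≢T slack′ (λ w≤u → v≰u (≤[]-trans {v} {w} {u} v≤w w≤u)))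
          where
          slack′ : weight T ≤ weight w + k
          slack′ = ≤-trans slack (subst (_≤ weight w + k) (sym (+-suc (weight v) k))
                     (+-monoˡ-≤ k (weight-strict {v} {w} sv sw v≤w (≢-sym w≢v))))

    below-joinIrreducible : ∀ v → IsSTree n s v → v ≤[ s ] T → v ≢ T → ¬ ¬ (v ≤[ s ] u)
    below-joinIrreducible v sv v≤T v≢T = below-by-slack (weight T) v sv v≤T v≢T (m≤n+m (weight T) (weight v))

module DecoratedCombPositions (n : ℕ) (s : Vec ℕ n) (deco : Decoration) (os : List ℕ)
  (st : IsSTree n s (Combs.Decorated.decoratedComb (sAt s) deco os)) (asc : Ascending os) where
  private σ = sAt s
  open Combs σ
  open Decorated deco
  open WellFormed σ
  open STrees n s

  private
    edges : ∀ {a b p q} → At a p (decoratedComb os) → At b q (decoratedComb os) →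
            pos s (decoratedComb os) a b ≡ σ a ⊓ edgesRightOf p q (suc (σ a))
    edges at-a at-b = cong (σ _ ⊓_) (rightEdges-address (proj₂ st) (sTree-distinct st) at-a at-b)

  pos-spine-spine : ∀ a b → a ∈ os → b ∈ os → pos s (decoratedComb os) a b ≡ 0
  pos-spine-spine a b a∈ b∈
    rewrite edges (spine-at os a a∈) (spine-at os b b∈) | edgesRightOf-rightComb os a b a∈ b∈ = ⊓-zeroʳ (σ a)

  pos-slot-spine : ∀ a b c y → c ∈ os → 1 ≤ y → y ≤ σ c → a ∈ deco c y → b ∈ os →
                   pos s (decoratedComb os) a b ≡ 0
  pos-slot-spine a b c y c∈ 1≤y y≤σc a∈ b∈
    rewrite edges (slot-at os c y a c∈ 1≤y y≤σc a∈) (spine-at os b b∈)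
          | edgesRightOf-slot-spine os c y (rightCombAddress (deco c y) a) b c∈ 1≤y y≤σc (suc (σ a))
    = ⊓-zeroʳ (σ a)

  pos-spine-ownSlot : ∀ b c y → c ∈ os → 1 ≤ y → y ≤ σ c → b ∈ deco c y → pos s (decoratedComb os) c b ≡ y
  pos-spine-ownSlot b c y c∈ 1≤y y≤σc b∈
    rewrite edges (spine-at os c c∈) (slot-at os c y b c∈ 1≤y y≤σc b∈)
          | edgesRightOf-spine-ownSlot os c y (rightCombAddress (deco c y) b) c∈ y≤σc
    = m≥n⇒m⊓n≡n y≤σc

  pos-spine-laterSlot : ∀ a b c y → a ∈ os → c ∈ os → a < c → 1 ≤ y → y ≤ σ c → b ∈ deco c y →
                        pos s (decoratedComb os) a b ≡ 0
  pos-spine-laterSlot a b c y a∈ c∈ a<c 1≤y y≤σc b∈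
    rewrite edges (spine-at os a a∈) (slot-at os c y b c∈ 1≤y y≤σc b∈)
          | edgesRightOf-spine-laterSlot os a c y (rightCombAddress (deco c y) b) asc a∈ c∈ a<c
    = ⊓-zeroʳ (σ a)

  pos-spine-earlierSlot : ∀ a b c y → a ∈ os → c ∈ os → c < a → 1 ≤ y → y ≤ σ c → b ∈ deco c y →
                          pos s (decoratedComb os) a b ≡ σ a
  pos-spine-earlierSlot a b c y a∈ c∈ c<a 1≤y y≤σc b∈
    rewrite edges (spine-at os a a∈) (slot-at os c y b c∈ 1≤y y≤σc b∈)
          | edgesRightOf-spine-earlierSlot os a c y (rightCombAddress (deco c y) b) asc a∈ c∈ c<a 1≤y y≤σc (suc (σ a))
    = m≤n⇒m⊓n≡m (n≤1+n (σ a))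

  pos-sameSlot : ∀ a b c y → c ∈ os → 1 ≤ y → y ≤ σ c → a ∈ deco c y → b ∈ deco c y →
                 pos s (decoratedComb os) a b ≡ 0
  pos-sameSlot a b c y c∈ 1≤y y≤σc a∈ b∈
    rewrite edges (slot-at os c y a c∈ 1≤y y≤σc a∈) (slot-at os c y b c∈ 1≤y y≤σc b∈)
          | edgesRightOf-sameNode os c y (rightCombAddress (deco c y) a) y (rightCombAddress (deco c y) b) c∈ (suc (σ a))
          | edgesRightOf-same (σ c ∸ y) (rightCombAddress (deco c y) a) (rightCombAddress (deco c y) b) (suc (σ a))
          | edgesRightOf-rightComb (deco c y) a b a∈ b∈
    = ⊓-zeroʳ (σ a)

  pos-leftSlot-rightSlot : ∀ a b c y′ y → c ∈ os → 1 ≤ y → y < y′ → y′ ≤ σ c → a ∈ deco c y′ → b ∈ deco c y →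
                           pos s (decoratedComb os) a b ≡ 0
  pos-leftSlot-rightSlot a b c y′ y c∈ 1≤y y<y′ y′≤σc a∈ b∈
    rewrite edges (slot-at os c y′ a c∈ (≤-trans 1≤y (<⇒≤ y<y′)) y′≤σc a∈)
                  (slot-at os c y b c∈ 1≤y (≤-trans (<⇒≤ y<y′) y′≤σc) b∈)
          | edgesRightOf-sameNode os c y′ (rightCombAddress (deco c y′) a) y (rightCombAddress (deco c y) b) c∈ (suc (σ a))
          | edgesRightOf-< (rightCombAddress (deco c y′) a) (rightCombAddress (deco c y) b) (suc (σ a))
                           (∸-monoʳ-< y<y′ y′≤σc)
    = ⊓-zeroʳ (σ a)

  pos-slot-laterSlot : ∀ a b c′ y′ c y → c′ ∈ os → c ∈ os → c′ < c → 1 ≤ y′ → y′ ≤ σ c′ → 1 ≤ y → y ≤ σ c →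
                       a ∈ deco c′ y′ → b ∈ deco c y → pos s (decoratedComb os) a b ≡ 0
  pos-slot-laterSlot a b c′ y′ c y c′∈ c∈ c′<c 1≤y′ y′≤σc′ 1≤y y≤σc a∈ b∈
    rewrite edges (slot-at os c′ y′ a c′∈ 1≤y′ y′≤σc′ a∈) (slot-at os c y b c∈ 1≤y y≤σc b∈)
          | edgesRightOf-slot-laterSlot os c′ y′ (rightCombAddress (deco c′ y′) a) c y (rightCombAddress (deco c y) b)
                                        asc c′∈ c∈ c′<c 1≤y′ y′≤σc′ (suc (σ a))
    = ⊓-zeroʳ (σ a)

-- T_∨ and its positions

module JoinTree (n : ℕ) (s : Vec ℕ n) (i j r : ℕ) (A : ℕ → Bool)
  (1≤i : 1 ≤ i) (i<j : i < j) (j≤n : j ≤ n) (1≤r : 1 ≤ r) (r≤σi : r ≤ sAt s i)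
  (A-range : ∀ b → A b ≡ true → i < b × b < j × sAt s b ≢ 0) where

  private σ = sAt s
  open Combs σ
  open STrees n s
  open WeakOrder n s

  inner : ℕ → Bool
  inner b = A b ∨ (b ≡ᵇ j)

  outer : ℕ → Bool
  outer b = not (inner b)

  allLabels I O Aₗ : List ℕ
  allLabels = fromTo 1 n
  I = filterBy inner allLabels
  O = filterBy outer allLabels
  Aₗ = filterBy A allLabels

  ∈-allLabels⁺ : ∀ {b} → 1 ≤ b → b ≤ n → b ∈ allLabels
  ∈-allLabels⁺ 1≤b b≤n = ∈-fromTo⁺ 1 n 1≤b (s≤s b≤n)

  ∈-allLabels⁻ : ∀ {b} → b ∈ allLabels → 1 ≤ b × b ≤ n
  ∈-allLabels⁻ b∈ = Product.map₂ ≤-pred (∈-fromTo⁻ 1 n b∈)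

  allLabels-ascending = fromTo-ascending 1 n
  I-ascending = filterBy-ascending inner allLabels allLabels-ascending
  O-ascending = filterBy-ascending outer allLabels allLabels-ascending
  Aₗ-ascending = filterBy-ascending A allLabels allLabels-ascending

  inner⇒i< : ∀ b → inner b ≡ true → i < b
  inner⇒i< b e with ∨-true-split (A b) (b ≡ᵇ j) e
  ... | inj₁ Ab  = proj₁ (A-range b Ab)
  ... | inj₂ b≡j = subst (i <_) (sym (≡ᵇ-true⇒≡ b j b≡j)) i<j

  inner⇒≤j : ∀ b → inner b ≡ true → b ≤ j
  inner⇒≤j b e with ∨-true-split (A b) (b ≡ᵇ j) e
  ... | inj₁ Ab  = <⇒≤ (proj₁ (proj₂ (A-range b Ab)))
  ... | inj₂ b≡j = ≤-reflexive (≡ᵇ-true⇒≡ b j b≡j)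

  ∈I⇒range : ∀ {b} → b ∈ I → i < b × b ≤ j × b ≤ n
  ∈I⇒range {b} b∈ with ∈-filterBy⁻ inner allLabels b∈
  ... | b∈all , e = inner⇒i< b e , inner⇒≤j b e , proj₂ (∈-allLabels⁻ b∈all)

  A-i : A i ≡ false
  A-i = ¬-not (λ e → <-irrefl refl (proj₁ (A-range i e)))

  A-j : A j ≡ false
  A-j = ¬-not (λ e → <-irrefl refl (proj₁ (proj₂ (A-range j e))))

  i∈allLabels = ∈-allLabels⁺ 1≤i (≤-trans (<⇒≤ i<j) j≤n)
  j∈allLabels = ∈-allLabels⁺ (≤-trans 1≤i (<⇒≤ i<j)) j≤n

  i∈O : i ∈ O
  i∈O = ∈-filterBy⁺ outer allLabels i∈allLabels (cong not (trans (cong (_∨ (i ≡ᵇ j)) A-i) (≢⇒≡ᵇ-false i j (<⇒≢ i<j))))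

  j∈I : j ∈ I
  j∈I = ∈-filterBy⁺ inner allLabels j∈allLabels (∨-trueʳ (A j) (≡ᵇ-refl j))

  ∈I⇒inner : ∀ {b} → b ∈ I → inner b ≡ true
  ∈I⇒inner b∈ = proj₂ (∈-filterBy⁻ inner allLabels b∈)

  ∈O⇒¬inner : ∀ {b} → b ∈ O → inner b ≡ false
  ∈O⇒¬inner {b} b∈ = trans (sym (not-involutive (inner b))) (cong not (proj₂ (∈-filterBy⁻ outer allLabels b∈)))

  ∈Aₗ⇒∈I : ∀ {b} → b ∈ Aₗ → b ∈ I
  ∈Aₗ⇒∈I {b} b∈ with ∈-filterBy⁻ A allLabels b∈
  ... | b∈all , Ab = ∈-filterBy⁺ inner allLabels b∈all (subst (λ x → x ∨ (b ≡ᵇ j) ≡ true) (sym Ab) refl)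

  ∈Aₗ⇒range : ∀ {b} → b ∈ Aₗ → i < b × b < j × σ b ≢ 0
  ∈Aₗ⇒range {b} b∈ = A-range b (proj₂ (∈-filterBy⁻ A allLabels b∈))

  ∈I⇒∈Aₗ⊎≡j : ∀ {b} → b ∈ I → b ∈ Aₗ ⊎ b ≡ j
  ∈I⇒∈Aₗ⊎≡j {b} b∈ with ∈-filterBy⁻ inner allLabels b∈
  ... | b∈all , e with ∨-true-split (A b) (b ≡ᵇ j) e
  ...   | inj₁ Ab  = inj₁ (∈-filterBy⁺ A allLabels b∈all Ab)
  ...   | inj₂ b≡j = inj₂ (≡ᵇ-true⇒≡ b j b≡j)

  ∈O⊎∈I : ∀ {b} → b ∈ allLabels → b ∈ O ⊎ b ∈ I
  ∈O⊎∈I {b} b∈ with inner b in e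
  ... | true  = inj₂ (∈-filterBy⁺ inner allLabels b∈ e)
  ... | false = inj₁ (∈-filterBy⁺ outer allLabels b∈ (cong not e))

  T∨-decoration : Decoration
  T∨-decoration = addDecoration i r I noDecoration

  open Decorated T∨-decoration using () renaming (decoratedComb to decoratedComb∨)

  T∨ : Tree
  T∨ = decoratedComb∨ O

  T∨-sTree : IsSTree n s T∨
  T∨-sTree = mkSTree
    (↭-trans (Decorated.labels-decoratedComb T∨-decoration O)
             (subst (λ L → O ++ L ↭ allLabels) (sym allDecorations≡I) (filterBy-partition inner allLabels)))
    (Decorated.WF-decoratedComb T∨-decoration
       (addDecoration-ascending i r I noDecoration I-ascending (All.tabulate (λ b∈ → inner⇒i< _ (∈I⇒inner b∈)))
                                noDecoration-ascending)
       O O-ascending)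
    where
    open Decorated T∨-decoration using (allDecorations; decorations-none; decorations-single)
    allDecorations≡I : allDecorations O ≡ I
    allDecorations≡I =
      trans (concatMap-single _ O i O-ascending i∈O
               (λ o _ o≢i → decorations-none o (σ o) (λ y _ → addDecoration-node≢ i r I noDecoration o y o≢i)))
        (trans (decorations-single i (σ i) r 1≤r r≤σi (λ y _ y≢r → addDecoration-slot≢ i r I noDecoration y y≢r))
               (addDecoration-here i r I noDecoration))

  private module T∨-positions = DecoratedCombPositions n s T∨-decoration O T∨-sTree O-ascending

  ∈I⇒decorates-i : ∀ {b} → b ∈ I → b ∈ T∨-decoration i r
  ∈I⇒decorates-i b∈ = subst (_ ∈_) (sym (addDecoration-here i r I noDecoration)) b∈

  pos-T∨-O : ∀ a b → a ∈ allLabels → b ∈ O → pos s T∨ a b ≡ 0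
  pos-T∨-O a b a∈ b∈ with ∈O⊎∈I a∈
  ... | inj₁ a∈O = T∨-positions.pos-spine-spine a b a∈O b∈
  ... | inj₂ a∈I = T∨-positions.pos-slot-spine a b i r i∈O 1≤r r≤σi (∈I⇒decorates-i a∈I) b∈

  pos-T∨-I-I : ∀ a b → a ∈ I → b ∈ I → pos s T∨ a b ≡ 0
  pos-T∨-I-I a b a∈ b∈ = T∨-positions.pos-sameSlot a b i r i∈O 1≤r r≤σi (∈I⇒decorates-i a∈) (∈I⇒decorates-i b∈)

  pos-T∨-i-I : ∀ b → b ∈ I → pos s T∨ i b ≡ r
  pos-T∨-i-I b b∈ = T∨-positions.pos-spine-ownSlot b i r i∈O 1≤r r≤σi (∈I⇒decorates-i b∈)

  pos-T∨-<i : ∀ a b → a ∈ O → a < i → b ∈ I → pos s T∨ a b ≡ 0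
  pos-T∨-<i a b a∈ a<i b∈ = T∨-positions.pos-spine-laterSlot a b i r a∈ i∈O a<i 1≤r r≤σi (∈I⇒decorates-i b∈)

  pos-T∨->i : ∀ a b → a ∈ O → i < a → b ∈ I → pos s T∨ a b ≡ σ a
  pos-T∨->i a b a∈ i<a b∈ = T∨-positions.pos-spine-earlierSlot a b i r a∈ i∈O i<a 1≤r r≤σi (∈I⇒decorates-i b∈)

  pos-T∨-ij : pos s T∨ i j ≡ r
  pos-T∨-ij = pos-T∨-i-I j j∈I

  pos-T∨-nonzero : ∀ a b → 1 ≤ a → a < b → b ≤ n → pos s T∨ a b ≢ 0 → b ∈ I × (a ≡ i ⊎ (i < a × a ∈ O))
  pos-T∨-nonzero a b 1≤a a<b b≤n nz = classify (∈O⊎∈I b∈) (∈O⊎∈I a∈)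
    where
    a∈ = ∈-allLabels⁺ 1≤a (≤-trans (<⇒≤ a<b) b≤n)
    b∈ = ∈-allLabels⁺ (≤-trans 1≤a (<⇒≤ a<b)) b≤n
    classify : b ∈ O ⊎ b ∈ I → a ∈ O ⊎ a ∈ I → b ∈ I × (a ≡ i ⊎ (i < a × a ∈ O))
    classify (inj₁ b∈O) _          = ⊥-elim (nz (pos-T∨-O a b a∈ b∈O))
    classify (inj₂ b∈I) (inj₂ a∈I) = ⊥-elim (nz (pos-T∨-I-I a b a∈I b∈I))
    classify (inj₂ b∈I) (inj₁ a∈O) with <-cmp a i
    ... | tri< a<i _ _ = ⊥-elim (nz (pos-T∨-<i a b a∈O a<i b∈I))
    ... | tri≈ _ a≡i _ = b∈I , inj₁ a≡i
    ... | tri> _ _ i<a = b∈I , inj₂ (i<a , a∈O)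

  T∨-below : ∀ V → (∀ b → b ∈ I → r ≤ pos s V i b) →
             (∀ a b → a ∈ O → i < a → a < b → b ∈ I → σ a ≤ pos s V a b) → T∨ ≤[ s ] V
  T∨-below V at-i right-of-i a b 1≤a a<b b≤n = by-position (∈O⊎∈I b∈) (∈O⊎∈I a∈)
    where
    a∈ = ∈-allLabels⁺ 1≤a (≤-trans (<⇒≤ a<b) b≤n)
    b∈ = ∈-allLabels⁺ (≤-trans 1≤a (<⇒≤ a<b)) b≤n
    by-position : b ∈ O ⊎ b ∈ I → a ∈ O ⊎ a ∈ I → pos s T∨ a b ≤ pos s V a b
    by-position (inj₁ b∈O) _ rewrite pos-T∨-O a b a∈ b∈O = z≤n
    by-position (inj₂ b∈I) (inj₂ a∈I) rewrite pos-T∨-I-I a b a∈I b∈I = z≤n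
    by-position (inj₂ b∈I) (inj₁ a∈O) with <-cmp a i
    ... | tri< a<i _ _  rewrite pos-T∨-<i a b a∈O a<i b∈I = z≤n
    ... | tri≈ _ refl _ rewrite pos-T∨-i-I b b∈I = at-i b b∈I
    ... | tri> _ _ i<a  rewrite pos-T∨->i a b a∈O i<a b∈I = right-of-i a b a∈O i<a a<b b∈I

  -- By planarity, each b ∈ A (where s_b ≠ 0) is seen from i at least as far
  -- left as j, and then each a ∈ O between i and b has b entirely on its left.
  T∨-below-if-pos-ij : ∀ V → IsSTree n s V → V ≤[ s ] T∨ → pos s T∨ i j ≤ pos s V i j → T∨ ≤[ s ] V
  T∨-below-if-pos-ij V sV V≤T∨ r≤V = T∨-below V at-i right-of-i
    where
    r≤Vij : r ≤ pos s V i j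
    r≤Vij = subst (_≤ pos s V i j) pos-T∨-ij r≤V
    at-i : ∀ b → b ∈ I → r ≤ pos s V i b
    at-i b b∈ with ∈I⇒∈Aₗ⊎≡j b∈
    ... | inj₂ refl = r≤Vij
    ... | inj₁ b∈A with ∈Aₗ⇒range b∈A
    ...   | i<b , b<j , σb≢0 with pos s V i b <? pos s V i j
    ...     | no ≮ = ≤-trans r≤Vij (≮⇒≥ ≮)
    ...     | yes lt = ⊥-elim (σb≢0 (n≤0⇒n≡0 (subst (_≤ 0) (pos-planarity V sV i b j 1≤i i<b b<j j≤n lt)
                         (subst (pos s V b j ≤_) (pos-T∨-I-I b j b∈ j∈I) (V≤T∨ b j (≤-trans 1≤i (<⇒≤ i<b)) b<j j≤n)))))
    right-of-i : ∀ a b → a ∈ O → i < a → a < b → b ∈ I → σ a ≤ pos s V a b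
    right-of-i a b a∈ i<a a<b b∈ = ≤-reflexive (sym (pos-planarity V sV i a b 1≤i i<a a<b b≤n
      (subst (_< pos s V i b) (sym Via≡0) (<-≤-trans 1≤r (at-i b b∈)))))
      where
      b≤n = proj₂ (∈-allLabels⁻ (proj₁ (∈-filterBy⁻ inner allLabels b∈)))
      Via≡0 : pos s V i a ≡ 0
      Via≡0 = n≤0⇒n≡0 (subst (pos s V i a ≤_) (pos-T∨-O i a i∈allLabels a∈) (V≤T∨ i a 1≤i i<a (≤-trans (<⇒≤ a<b) b≤n)))

  T∨-joinIrreducible-if-lowerCover : ∀ U → IsSTree n s U →
    (∀ a b → 1 ≤ a → a < b → b ≤ n → (a ≡ i → b ≡ j → ⊥) → pos s U a b ≡ pos s T∨ a b) →
    pos s U i j ≡ r ∸ 1 → JoinIrreducible n s T∨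
  T∨-joinIrreducible-if-lowerCover U sU same-off-ij U-ij =
    joinIrreducible-criterion {T∨} {U} i j T∨-sTree sU U≤T∨ U<T∨ below-U (λ v sv → T∨-below-if-pos-ij v sv)
    where
    r∸1<r : r ∸ 1 < r
    r∸1<r = ∸-monoʳ-< (s≤s z≤n) 1≤r
    U<T∨ : pos s U i j < pos s T∨ i j
    U<T∨ rewrite U-ij | pos-T∨-ij = r∸1<r
    U≤T∨ : U ≤[ s ] T∨
    U≤T∨ a b 1≤a a<b b≤n with a ≟ i | b ≟ j
    ... | yes refl | yes refl = <⇒≤ U<T∨
    ... | no a≢i   | _        = ≤-reflexive (same-off-ij a b 1≤a a<b b≤n (λ a≡i _ → a≢i a≡i))
    ... | yes _    | no b≢j   = ≤-reflexive (same-off-ij a b 1≤a a<b b≤n (λ _ b≡j → b≢j b≡j))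
    below-U : ∀ v → IsSTree n s v → v ≤[ s ] T∨ → pos s v i j < pos s T∨ i j → v ≤[ s ] U
    below-U v sv v≤T∨ lt a b 1≤a a<b b≤n with a ≟ i | b ≟ j
    ... | yes refl | yes refl rewrite U-ij =
      ≤-pred (≤-trans (subst (_ <_) pos-T∨-ij lt) (≤-reflexive (sym (m+[n∸m]≡n {1} {r} 1≤r))))
    ... | no a≢i   | _      =
      ≤-trans (v≤T∨ a b 1≤a a<b b≤n) (≤-reflexive (sym (same-off-ij a b 1≤a a<b b≤n (λ a≡i _ → a≢i a≡i))))
    ... | yes _    | no b≢j =
      ≤-trans (v≤T∨ a b 1≤a a<b b≤n) (≤-reflexive (sym (same-off-ij a b 1≤a a<b b≤n (λ _ b≡j → b≢j b≡j))))

  ∈O⊎∈Aₗ⊎≡j : ∀ {b} → b ∈ allLabels → b ∈ O ⊎ b ∈ Aₗ ⊎ b ≡ j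
  ∈O⊎∈Aₗ⊎≡j b∈ with ∈O⊎∈I b∈
  ... | inj₁ b∈O = inj₁ b∈O
  ... | inj₂ b∈I = inj₂ (∈I⇒∈Aₗ⊎≡j b∈I)

  j∉Aₗ : j ∉ Aₗ
  j∉Aₗ j∈ = <-irrefl refl (proj₁ (proj₂ (∈Aₗ⇒range j∈)))

  Aₗ-above-i : All (i <_) Aₗ
  Aₗ-above-i = All.tabulate (λ b∈ → proj₁ (∈Aₗ⇒range b∈))

  Aₗ++j↭I : Aₗ ++ j ∷ [] ↭ I
  Aₗ++j↭I = unique-same-elements⇒↭
    (Unique++⁺ (ascending⇒unique Aₗ-ascending) ([] ∷ []) (λ { (j∈ , here refl) → j∉Aₗ j∈ }))
    (ascending⇒unique I-ascending)
    (λ b∈ → [ ∈Aₗ⇒∈I , (λ { (here refl) → j∈I }) ]′ (∈-++⁻ Aₗ b∈))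
    (λ b∈ → [ ∈-++⁺ˡ , (λ { refl → ∈-++⁺ʳ Aₗ (here refl) }) ]′ (∈I⇒∈Aₗ⊎≡j b∈))

  O++Aₗ++j↭allLabels : O ++ Aₗ ++ j ∷ [] ↭ allLabels
  O++Aₗ++j↭allLabels = ↭-trans (++⁺ˡ O Aₗ++j↭I) (filterBy-partition inner allLabels)

  -- For r ≥ 2, the lower cover moves j one edge to the right at i.
  module SlotLowerCover (2≤r : 2 ≤ r) where
    r′ = r ∸ 1
    1≤r′ : 1 ≤ r′
    1≤r′ = ∸-monoˡ-≤ 1 2≤r
    r′<r : r′ < r
    r′<r = ∸-monoʳ-< (s≤s z≤n) 1≤r
    r′≤σi : r′ ≤ σ i
    r′≤σi = ≤-trans (<⇒≤ r′<r) r≤σi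

    j-at-r′ decoration : Decoration
    j-at-r′ = addDecoration i r′ (j ∷ []) noDecoration
    decoration = addDecoration i r Aₗ j-at-r′

    open Decorated decoration using (decoratedComb; allDecorations; decorations-none; decorations-pair)

    U : Tree
    U = decoratedComb O

    decoration-i-r : decoration i r ≡ Aₗ
    decoration-i-r = addDecoration-here i r Aₗ j-at-r′

    decoration-i-r′ : decoration i r′ ≡ j ∷ []
    decoration-i-r′ = trans (addDecoration-slot≢ i r Aₗ j-at-r′ r′ (<⇒≢ r′<r)) (addDecoration-here i r′ (j ∷ []) noDecoration)

    U-sTree : IsSTree n s U
    U-sTree = mkSTree
      (↭-trans (Decorated.labels-decoratedComb decoration O)
               (subst (λ L → O ++ L ↭ allLabels) (sym allDecorations≡) O++Aₗ++j↭allLabels))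
      (Decorated.WF-decoratedComb decoration
         (addDecoration-ascending i r Aₗ j-at-r′ Aₗ-ascending Aₗ-above-i
           (addDecoration-ascending i r′ (j ∷ []) noDecoration ([] ∷ []) (i<j ∷ []) noDecoration-ascending))
         O O-ascending)
      where
      undecorated : ∀ o y → o ≢ i → decoration o y ≡ []
      undecorated o y o≢i =
        trans (addDecoration-node≢ i r Aₗ j-at-r′ o y o≢i) (addDecoration-node≢ i r′ (j ∷ []) noDecoration o y o≢i)
      allDecorations≡ : allDecorations O ≡ Aₗ ++ j ∷ []
      allDecorations≡ =
        trans (concatMap-single _ O i O-ascending i∈O (λ o _ o≢i → decorations-none o (σ o) (λ y _ → undecorated o y o≢i)))
          (trans (decorations-pair i (σ i) r r′ 1≤r′ r′<r r≤σi
                    (λ y _ y≢r y≢r′ → trans (addDecoration-slot≢ i r Aₗ j-at-r′ y y≢r)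
                                            (addDecoration-slot≢ i r′ (j ∷ []) noDecoration y y≢r′)))
                 (cong₂ _++_ decoration-i-r decoration-i-r′))

    open DecoratedCombPositions n s decoration O U-sTree O-ascending

    ∈Aₗ⇒decorates : ∀ {b} → b ∈ Aₗ → b ∈ decoration i r
    ∈Aₗ⇒decorates b∈ = subst (_ ∈_) (sym decoration-i-r) b∈

    j-decorates : j ∈ decoration i r′
    j-decorates = subst (j ∈_) (sym decoration-i-r′) (here refl)

    pos-U-ij : pos s U i j ≡ r ∸ 1
    pos-U-ij = pos-spine-ownSlot j i r′ i∈O 1≤r′ r′≤σi j-decorates

    pos-U-O : ∀ a b → a ∈ allLabels → b ∈ O → pos s U a b ≡ 0
    pos-U-O a b a∈ b∈ with ∈O⊎∈Aₗ⊎≡j a∈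
    ... | inj₁ a∈O        = pos-spine-spine a b a∈O b∈
    ... | inj₂ (inj₁ a∈A) = pos-slot-spine a b i r i∈O 1≤r r≤σi (∈Aₗ⇒decorates a∈A) b∈
    ... | inj₂ (inj₂ refl) = pos-slot-spine j b i r′ i∈O 1≤r′ r′≤σi j-decorates b∈

    U-agrees-off-ij : ∀ a b → 1 ≤ a → a < b → b ≤ n → (a ≡ i → b ≡ j → ⊥) → pos s U a b ≡ pos s T∨ a b
    U-agrees-off-ij a b 1≤a a<b b≤n not-ij = by-position (∈O⊎∈Aₗ⊎≡j b∈) (∈O⊎∈Aₗ⊎≡j a∈)
      where
      a∈ = ∈-allLabels⁺ 1≤a (≤-trans (<⇒≤ a<b) b≤n)
      b∈ = ∈-allLabels⁺ (≤-trans 1≤a (<⇒≤ a<b)) b≤n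
      by-position : b ∈ O ⊎ b ∈ Aₗ ⊎ b ≡ j → a ∈ O ⊎ a ∈ Aₗ ⊎ a ≡ j → pos s U a b ≡ pos s T∨ a b
      by-position (inj₁ b∈O) _ = trans (pos-U-O a b a∈ b∈O) (sym (pos-T∨-O a b a∈ b∈O))
      by-position (inj₂ (inj₁ b∈A)) (inj₂ (inj₂ refl)) = ⊥-elim (<-asym a<b (proj₁ (proj₂ (∈Aₗ⇒range b∈A))))
      by-position (inj₂ (inj₁ b∈A)) (inj₂ (inj₁ a∈A)) =
        trans (pos-sameSlot a b i r i∈O 1≤r r≤σi (∈Aₗ⇒decorates a∈A) (∈Aₗ⇒decorates b∈A))
              (sym (pos-T∨-I-I a b (∈Aₗ⇒∈I a∈A) (∈Aₗ⇒∈I b∈A)))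
      by-position (inj₂ (inj₁ b∈A)) (inj₁ a∈O) with <-cmp a i
      ... | tri< a<i _ _ = trans (pos-spine-laterSlot a b i r a∈O i∈O a<i 1≤r r≤σi (∈Aₗ⇒decorates b∈A))
                                 (sym (pos-T∨-<i a b a∈O a<i (∈Aₗ⇒∈I b∈A)))
      ... | tri≈ _ refl _ = trans (pos-spine-ownSlot b i r i∈O 1≤r r≤σi (∈Aₗ⇒decorates b∈A))
                                  (sym (pos-T∨-i-I b (∈Aₗ⇒∈I b∈A)))
      ... | tri> _ _ i<a = trans (pos-spine-earlierSlot a b i r a∈O i∈O i<a 1≤r r≤σi (∈Aₗ⇒decorates b∈A))
                                 (sym (pos-T∨->i a b a∈O i<a (∈Aₗ⇒∈I b∈A)))
      by-position (inj₂ (inj₂ refl)) (inj₂ (inj₂ refl)) = ⊥-elim (<-irrefl refl a<b)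
      by-position (inj₂ (inj₂ refl)) (inj₂ (inj₁ a∈A)) =
        trans (pos-leftSlot-rightSlot a j i r r′ i∈O 1≤r′ r′<r r≤σi (∈Aₗ⇒decorates a∈A) j-decorates)
              (sym (pos-T∨-I-I a j (∈Aₗ⇒∈I a∈A) j∈I))
      by-position (inj₂ (inj₂ refl)) (inj₁ a∈O) with <-cmp a i
      ... | tri< a<i _ _ = trans (pos-spine-laterSlot a j i r′ a∈O i∈O a<i 1≤r′ r′≤σi j-decorates)
                                 (sym (pos-T∨-<i a j a∈O a<i j∈I))
      ... | tri≈ _ a≡i _ = ⊥-elim (not-ij a≡i refl)
      ... | tri> _ _ i<a = trans (pos-spine-earlierSlot a j i r′ a∈O i∈O i<a 1≤r′ r′≤σi j-decorates)
                                 (sym (pos-T∨->i a j a∈O i<a j∈I))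

  inB : ℕ → Bool
  inB b = (i <ᵇ b) ∧ ((b <ᵇ j) ∧ (not (σ b ≡ᵇ 0) ∧ not (A b)))

  Bₗ : List ℕ
  Bₗ = filterBy inB allLabels

  ∈Bₗ⇒range : ∀ {b} → b ∈ Bₗ → i < b × b < j × σ b ≢ 0
  ∈Bₗ⇒range {b} b∈ with ∧-true-split (i <ᵇ b) _ (proj₂ (∈-filterBy⁻ inB allLabels b∈))
  ... | i<b , rest with ∧-true-split (b <ᵇ j) _ rest
  ...   | b<j , rest′ with ∧-true-split (not (σ b ≡ᵇ 0)) _ rest′
  ...     | σb≢0 , _ = <ᵇ-true⇒< i<b , <ᵇ-true⇒< b<j , ≡ᵇ-false⇒≢ (σ b) 0 (trans (sym (not-involutive _)) (cong not σb≢0))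

  ∈Bₗ⇒∈O : ∀ {b} → b ∈ Bₗ → b ∈ O
  ∈Bₗ⇒∈O {b} b∈ with ∈-filterBy⁻ inB allLabels b∈
  ... | b∈all , e with ∧-true-split (i <ᵇ b) _ e
  ...   | _ , rest with ∧-true-split (b <ᵇ j) _ rest
  ...     | b<j , rest′ with ∧-true-split (not (σ b ≡ᵇ 0)) _ rest′
  ...       | _ , ¬Ab = ∈-filterBy⁺ outer allLabels b∈all (cong not (cong₂ _∨_
                (trans (sym (not-involutive _)) (cong not ¬Ab)) (≢⇒≡ᵇ-false b j (<⇒≢ (<ᵇ-true⇒< b<j)))))

  ∈O⇒∈Bₗ : ∀ {a} → a ∈ O → i < a → a < j → σ a ≢ 0 → a ∈ Bₗ
  ∈O⇒∈Bₗ {a} a∈ i<a a<j σa≢0 = ∈-filterBy⁺ inB allLabels (proj₁ (∈-filterBy⁻ outer allLabels a∈)) inB-a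
    where
    inB-a : inB a ≡ true
    inB-a rewrite <⇒<ᵇ-true i<a | <⇒<ᵇ-true a<j | ≢⇒≡ᵇ-false (σ a) 0 σa≢0
                | ∨-conicalˡ (A a) _ (∈O⇒¬inner a∈) = refl

  -- For r = 1, with b₀ the least element of B = {b ∈ ]i, j[ ∖ A : s_b ≠ 0},
  -- the lower cover moves j to the leftmost edge of b₀.
  module NodeLowerCover (r≡1 : r ≡ 1) (b₀ : ℕ) (b₀∈B : b₀ ∈ Bₗ) (b₀-least : ∀ {b} → b ∈ Bₗ → b₀ ≤ b) where
    i<b₀ = proj₁ (∈Bₗ⇒range b₀∈B)
    b₀<j = proj₁ (proj₂ (∈Bₗ⇒range b₀∈B))
    b₀∈O = ∈Bₗ⇒∈O b₀∈B
    1≤σb₀ : 1 ≤ σ b₀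
    1≤σb₀ = n≢0⇒n>0 (proj₂ (proj₂ (∈Bₗ⇒range b₀∈B)))
    1≤σi : 1 ≤ σ i
    1≤σi = ≤-trans 1≤r r≤σi

    j-at-b₀ decoration : Decoration
    j-at-b₀ = addDecoration b₀ (σ b₀) (j ∷ []) noDecoration
    decoration = addDecoration i 1 Aₗ j-at-b₀

    open Decorated decoration using (decoratedComb; allDecorations; decorations-none; decorations-single)

    U : Tree
    U = decoratedComb O

    decoration-i-1 : decoration i 1 ≡ Aₗ
    decoration-i-1 = addDecoration-here i 1 Aₗ j-at-b₀

    decoration-b₀ : decoration b₀ (σ b₀) ≡ j ∷ []
    decoration-b₀ = trans (addDecoration-node≢ i 1 Aₗ j-at-b₀ b₀ (σ b₀) (>⇒≢ i<b₀))
                          (addDecoration-here b₀ (σ b₀) (j ∷ []) noDecoration)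

    U-sTree : IsSTree n s U
    U-sTree = mkSTree
      (↭-trans (Decorated.labels-decoratedComb decoration O)
               (subst (λ L → O ++ L ↭ allLabels) (sym allDecorations≡) O++Aₗ++j↭allLabels))
      (Decorated.WF-decoratedComb decoration
         (addDecoration-ascending i 1 Aₗ j-at-b₀ Aₗ-ascending Aₗ-above-i
           (addDecoration-ascending b₀ (σ b₀) (j ∷ []) noDecoration ([] ∷ []) (b₀<j ∷ []) noDecoration-ascending))
         O O-ascending)
      where
      allDecorations≡ : allDecorations O ≡ Aₗ ++ j ∷ []
      allDecorations≡ =
        trans (concatMap-pair _ O i b₀ O-ascending i∈O b₀∈O i<b₀
                 (λ o _ o≢i o≢b₀ → decorations-none o (σ o) (λ y _ →
                    trans (addDecoration-node≢ i 1 Aₗ j-at-b₀ o y o≢i)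
                          (addDecoration-node≢ b₀ (σ b₀) (j ∷ []) noDecoration o y o≢b₀))))
          (cong₂ _++_
            (trans (decorations-single i (σ i) 1 ≤-refl 1≤σi (λ y _ y≢1 →
                      trans (addDecoration-slot≢ i 1 Aₗ j-at-b₀ y y≢1)
                            (addDecoration-node≢ b₀ (σ b₀) (j ∷ []) noDecoration i y (<⇒≢ i<b₀))))
                   decoration-i-1)
            (trans (decorations-single b₀ (σ b₀) (σ b₀) 1≤σb₀ ≤-refl (λ y _ y≢σb₀ →
                      trans (addDecoration-node≢ i 1 Aₗ j-at-b₀ b₀ y (>⇒≢ i<b₀))
                            (addDecoration-slot≢ b₀ (σ b₀) (j ∷ []) noDecoration y y≢σb₀)))
                   decoration-b₀))

    open DecoratedCombPositions n s decoration O U-sTree O-ascending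

    ∈Aₗ⇒decorates : ∀ {b} → b ∈ Aₗ → b ∈ decoration i 1
    ∈Aₗ⇒decorates b∈ = subst (_ ∈_) (sym decoration-i-1) b∈

    j-decorates : j ∈ decoration b₀ (σ b₀)
    j-decorates = subst (j ∈_) (sym decoration-b₀) (here refl)

    pos-U-ij : pos s U i j ≡ r ∸ 1
    pos-U-ij rewrite r≡1 = pos-spine-laterSlot i j b₀ (σ b₀) i∈O b₀∈O i<b₀ 1≤σb₀ ≤-refl j-decorates

    pos-U-O : ∀ a b → a ∈ allLabels → b ∈ O → pos s U a b ≡ 0
    pos-U-O a b a∈ b∈ with ∈O⊎∈Aₗ⊎≡j a∈
    ... | inj₁ a∈O         = pos-spine-spine a b a∈O b∈
    ... | inj₂ (inj₁ a∈A)  = pos-slot-spine a b i 1 i∈O ≤-refl 1≤σi (∈Aₗ⇒decorates a∈A) b∈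
    ... | inj₂ (inj₂ refl) = pos-slot-spine j b b₀ (σ b₀) b₀∈O 1≤σb₀ ≤-refl j-decorates b∈

    σ≡0-before-b₀ : ∀ a → a ∈ O → i < a → a < b₀ → σ a ≡ 0
    σ≡0-before-b₀ a a∈ i<a a<b₀ with σ a ≟ 0
    ... | yes σa≡0 = σa≡0
    ... | no σa≢0 = ⊥-elim (<⇒≱ a<b₀ (b₀-least (∈O⇒∈Bₗ a∈ i<a (<-trans a<b₀ b₀<j) σa≢0)))

    U-agrees-off-ij : ∀ a b → 1 ≤ a → a < b → b ≤ n → (a ≡ i → b ≡ j → ⊥) → pos s U a b ≡ pos s T∨ a b
    U-agrees-off-ij a b 1≤a a<b b≤n not-ij = by-position (∈O⊎∈Aₗ⊎≡j b∈) (∈O⊎∈Aₗ⊎≡j a∈)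
      where
      a∈ = ∈-allLabels⁺ 1≤a (≤-trans (<⇒≤ a<b) b≤n)
      b∈ = ∈-allLabels⁺ (≤-trans 1≤a (<⇒≤ a<b)) b≤n
      by-position : b ∈ O ⊎ b ∈ Aₗ ⊎ b ≡ j → a ∈ O ⊎ a ∈ Aₗ ⊎ a ≡ j → pos s U a b ≡ pos s T∨ a b
      by-position (inj₁ b∈O) _ = trans (pos-U-O a b a∈ b∈O) (sym (pos-T∨-O a b a∈ b∈O))
      by-position (inj₂ (inj₁ b∈A)) (inj₂ (inj₂ refl)) = ⊥-elim (<-asym a<b (proj₁ (proj₂ (∈Aₗ⇒range b∈A))))
      by-position (inj₂ (inj₁ b∈A)) (inj₂ (inj₁ a∈A)) =
        trans (pos-sameSlot a b i 1 i∈O ≤-refl 1≤σi (∈Aₗ⇒decorates a∈A) (∈Aₗ⇒decorates b∈A))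
              (sym (pos-T∨-I-I a b (∈Aₗ⇒∈I a∈A) (∈Aₗ⇒∈I b∈A)))
      by-position (inj₂ (inj₁ b∈A)) (inj₁ a∈O) with <-cmp a i
      ... | tri< a<i _ _ = trans (pos-spine-laterSlot a b i 1 a∈O i∈O a<i ≤-refl 1≤σi (∈Aₗ⇒decorates b∈A))
                                 (sym (pos-T∨-<i a b a∈O a<i (∈Aₗ⇒∈I b∈A)))
      ... | tri≈ _ refl _ = trans (pos-spine-ownSlot b i 1 i∈O ≤-refl 1≤σi (∈Aₗ⇒decorates b∈A))
                                  (trans (sym r≡1) (sym (pos-T∨-i-I b (∈Aₗ⇒∈I b∈A))))
      ... | tri> _ _ i<a = trans (pos-spine-earlierSlot a b i 1 a∈O i∈O i<a ≤-refl 1≤σi (∈Aₗ⇒decorates b∈A))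
                                 (sym (pos-T∨->i a b a∈O i<a (∈Aₗ⇒∈I b∈A)))
      by-position (inj₂ (inj₂ refl)) (inj₂ (inj₂ refl)) = ⊥-elim (<-irrefl refl a<b)
      by-position (inj₂ (inj₂ refl)) (inj₂ (inj₁ a∈A)) =
        trans (pos-slot-laterSlot a j i 1 b₀ (σ b₀) i∈O b₀∈O i<b₀ ≤-refl 1≤σi 1≤σb₀ ≤-refl (∈Aₗ⇒decorates a∈A) j-decorates)
              (sym (pos-T∨-I-I a j (∈Aₗ⇒∈I a∈A) j∈I))
      by-position (inj₂ (inj₂ refl)) (inj₁ a∈O) with <-cmp a b₀
      ... | tri≈ _ refl _ = trans (pos-spine-ownSlot j b₀ (σ b₀) b₀∈O 1≤σb₀ ≤-refl j-decorates)
                                  (sym (pos-T∨->i b₀ j b₀∈O i<b₀ j∈I))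
      ... | tri> _ _ b₀<a = trans (pos-spine-earlierSlot a j b₀ (σ b₀) a∈O b₀∈O b₀<a 1≤σb₀ ≤-refl j-decorates)
                                  (sym (pos-T∨->i a j a∈O (<-trans i<b₀ b₀<a) j∈I))
      ... | tri< a<b₀ _ _ with <-cmp a i
      ...   | tri< a<i _ _ = trans (pos-spine-laterSlot a j b₀ (σ b₀) a∈O b₀∈O a<b₀ 1≤σb₀ ≤-refl j-decorates)
                                   (sym (pos-T∨-<i a j a∈O a<i j∈I))
      ...   | tri≈ _ a≡i _ = ⊥-elim (not-ij a≡i refl)
      ...   | tri> _ _ i<a = trans (pos-spine-laterSlot a j b₀ (σ b₀) a∈O b₀∈O a<b₀ 1≤σb₀ ≤-refl j-decorates)
                                   (trans (sym (σ≡0-before-b₀ a a∈O i<a a<b₀)) (sym (pos-T∨->i a j a∈O i<a j∈I)))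

  -- For r = 1 and B empty, the lower cover moves j to the spine.
  module SpineLowerCover (r≡1 : r ≡ 1) (B-empty : ∀ {b} → b ∉ Bₗ) where
    1≤σi : 1 ≤ σ i
    1≤σi = ≤-trans 1≤r r≤σi

    notA : ℕ → Bool
    notA b = not (A b)

    spine : List ℕ
    spine = filterBy notA allLabels

    spine-ascending = filterBy-ascending notA allLabels allLabels-ascending

    i∈spine : i ∈ spine
    i∈spine = ∈-filterBy⁺ notA allLabels i∈allLabels (cong not A-i)

    j∈spine : j ∈ spine
    j∈spine = ∈-filterBy⁺ notA allLabels j∈allLabels (cong not A-j)

    decoration : Decoration
    decoration = addDecoration i 1 Aₗ noDecoration

    open Decorated decoration using (decoratedComb; allDecorations; decorations-none; decorations-single)

    U : Tree
    U = decoratedComb spine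

    U-sTree : IsSTree n s U
    U-sTree = mkSTree
      (↭-trans (Decorated.labels-decoratedComb decoration spine)
               (subst (λ L → spine ++ L ↭ allLabels) (sym allDecorations≡Aₗ) (filterBy-partition A allLabels)))
      (Decorated.WF-decoratedComb decoration
         (addDecoration-ascending i 1 Aₗ noDecoration Aₗ-ascending Aₗ-above-i noDecoration-ascending)
         spine spine-ascending)
      where
      allDecorations≡Aₗ : allDecorations spine ≡ Aₗ
      allDecorations≡Aₗ =
        trans (concatMap-single _ spine i spine-ascending i∈spine
                 (λ o _ o≢i → decorations-none o (σ o) (λ y _ → addDecoration-node≢ i 1 Aₗ noDecoration o y o≢i)))
          (trans (decorations-single i (σ i) 1 ≤-refl 1≤σi (λ y _ y≢1 → addDecoration-slot≢ i 1 Aₗ noDecoration y y≢1))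
                 (addDecoration-here i 1 Aₗ noDecoration))

    open DecoratedCombPositions n s decoration spine U-sTree spine-ascending

    ∈Aₗ⇒decorates : ∀ {b} → b ∈ Aₗ → b ∈ decoration i 1
    ∈Aₗ⇒decorates b∈ = subst (_ ∈_) (sym (addDecoration-here i 1 Aₗ noDecoration)) b∈

    ∈spine⊎∈Aₗ : ∀ {b} → b ∈ allLabels → b ∈ spine ⊎ b ∈ Aₗ
    ∈spine⊎∈Aₗ {b} b∈ with A b in e
    ... | true  = inj₂ (∈-filterBy⁺ A allLabels b∈ e)
    ... | false = inj₁ (∈-filterBy⁺ notA allLabels b∈ (cong not e))

    ∈spine⇒∈O : ∀ {a} → a ∈ spine → a ≢ j → a ∈ O
    ∈spine⇒∈O {a} a∈ a≢j with ∈-filterBy⁻ notA allLabels a∈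
    ... | a∈all , ¬Aa = ∈-filterBy⁺ outer allLabels a∈all
      (cong not (cong₂ _∨_ (trans (sym (not-involutive _)) (cong not ¬Aa)) (≢⇒≡ᵇ-false a j a≢j)))

    pos-U-spine : ∀ a b → a ∈ allLabels → b ∈ spine → pos s U a b ≡ 0
    pos-U-spine a b a∈ b∈ with ∈spine⊎∈Aₗ a∈
    ... | inj₁ a∈spine = pos-spine-spine a b a∈spine b∈
    ... | inj₂ a∈A     = pos-slot-spine a b i 1 i∈spine ≤-refl 1≤σi (∈Aₗ⇒decorates a∈A) b∈

    pos-U-ij : pos s U i j ≡ r ∸ 1
    pos-U-ij rewrite r≡1 = pos-U-spine i j i∈allLabels j∈spine

    σ≡0-before-j : ∀ a → a ∈ O → i < a → a < j → σ a ≡ 0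
    σ≡0-before-j a a∈ i<a a<j with σ a ≟ 0
    ... | yes σa≡0 = σa≡0
    ... | no σa≢0 = ⊥-elim (B-empty (∈O⇒∈Bₗ a∈ i<a a<j σa≢0))

    U-agrees-off-ij : ∀ a b → 1 ≤ a → a < b → b ≤ n → (a ≡ i → b ≡ j → ⊥) → pos s U a b ≡ pos s T∨ a b
    U-agrees-off-ij a b 1≤a a<b b≤n not-ij = by-position (∈spine⊎∈Aₗ b∈)
      where
      a∈ = ∈-allLabels⁺ 1≤a (≤-trans (<⇒≤ a<b) b≤n)
      b∈ = ∈-allLabels⁺ (≤-trans 1≤a (<⇒≤ a<b)) b≤n
      at-j : b ≡ j → a ∈ O ⊎ a ∈ I → pos s U a j ≡ pos s T∨ a j
      at-j _ (inj₂ a∈I) = trans (pos-U-spine a j a∈ j∈spine) (sym (pos-T∨-I-I a j a∈I j∈I))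
      at-j b≡j (inj₁ a∈O) with <-cmp a i
      ... | tri< a<i _ _ = trans (pos-U-spine a j a∈ j∈spine) (sym (pos-T∨-<i a j a∈O a<i j∈I))
      ... | tri≈ _ a≡i _ = ⊥-elim (not-ij a≡i b≡j)
      ... | tri> _ _ i<a = trans (pos-U-spine a j a∈ j∈spine)
                                 (trans (sym (σ≡0-before-j a a∈O i<a (subst (a <_) b≡j a<b))) (sym (pos-T∨->i a j a∈O i<a j∈I)))
      by-position : b ∈ spine ⊎ b ∈ Aₗ → pos s U a b ≡ pos s T∨ a b
      by-position (inj₁ b∈spine) with b ≟ j
      ... | no b≢j  = trans (pos-U-spine a b a∈ b∈spine) (sym (pos-T∨-O a b a∈ (∈spine⇒∈O b∈spine b≢j)))
      ... | yes b≡j = subst (λ x → pos s U a x ≡ pos s T∨ a x) (sym b≡j) (at-j b≡j (∈O⊎∈I a∈))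
      by-position (inj₂ b∈A) with ∈spine⊎∈Aₗ a∈
      ... | inj₂ a∈A =
        trans (pos-sameSlot a b i 1 i∈spine ≤-refl 1≤σi (∈Aₗ⇒decorates a∈A) (∈Aₗ⇒decorates b∈A))
              (sym (pos-T∨-I-I a b (∈Aₗ⇒∈I a∈A) (∈Aₗ⇒∈I b∈A)))
      ... | inj₁ a∈spine with ∈spine⇒∈O a∈spine (λ a≡j → <-asym (subst (_< b) a≡j a<b) (proj₁ (proj₂ (∈Aₗ⇒range b∈A))))
      ...   | a∈O with <-cmp a i
      ...     | tri< a<i _ _ = trans (pos-spine-laterSlot a b i 1 a∈spine i∈spine a<i ≤-refl 1≤σi (∈Aₗ⇒decorates b∈A))
                                     (sym (pos-T∨-<i a b a∈O a<i (∈Aₗ⇒∈I b∈A)))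
      ...     | tri≈ _ refl _ = trans (pos-spine-ownSlot b i 1 i∈spine ≤-refl 1≤σi (∈Aₗ⇒decorates b∈A))
                                      (trans (sym r≡1) (sym (pos-T∨-i-I b (∈Aₗ⇒∈I b∈A))))
      ...     | tri> _ _ i<a = trans (pos-spine-earlierSlot a b i 1 a∈spine i∈spine i<a ≤-refl 1≤σi (∈Aₗ⇒decorates b∈A))
                                     (sym (pos-T∨->i a b a∈O i<a (∈Aₗ⇒∈I b∈A)))

  T∨-joinIrreducible : JoinIrreducible n s T∨
  T∨-joinIrreducible with r ≟ 1
  ... | no r≢1 = T∨-joinIrreducible-if-lowerCover U U-sTree U-agrees-off-ij pos-U-ij
    where open SlotLowerCover (≤∧≢⇒< 1≤r (≢-sym r≢1))
  ... | yes r≡1 with Bₗ in Bₗ≡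
  ...   | [] = T∨-joinIrreducible-if-lowerCover U U-sTree U-agrees-off-ij pos-U-ij
    where open SpineLowerCover r≡1 (λ b∈ → case subst (_ ∈_) Bₗ≡ b∈ of λ ())
  ...   | b₀ ∷ _ = T∨-joinIrreducible-if-lowerCover U U-sTree U-agrees-off-ij pos-U-ij
    where
    Bₗ-ascending : Ascending (b₀ ∷ _)
    Bₗ-ascending = subst Ascending Bₗ≡ (filterBy-ascending inB allLabels allLabels-ascending)
    b₀-least : ∀ {b} → b ∈ Bₗ → b₀ ≤ b
    b₀-least b∈ with subst (_ ∈_) Bₗ≡ b∈ | Bₗ-ascending
    ... | here refl | _ = ≤-refl
    ... | there b∈′ | b₀< ∷ _ = <⇒≤ (All.lookup b₀< b∈′)
    open NodeLowerCover r≡1 b₀ (subst (b₀ ∈_) (sym Bₗ≡) (here refl)) b₀-least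

lookupOr : ∀ {A : Set} {n} → A → Vec A n → ℕ → A
lookupOr d []       _       = d
lookupOr d (x ∷ xs) zero    = x
lookupOr d (x ∷ xs) (suc m) = lookupOr d xs m

lookupOr-toℕ : ∀ {A : Set} {n} (d : A) (xs : Vec A n) (f : Fin n) → lookupOr d xs (toℕ f) ≡ lookup xs f
lookupOr-toℕ d (x ∷ xs) fzero = refl
lookupOr-toℕ d (x ∷ xs) (fsuc f) = lookupOr-toℕ d xs f

lookupOr-tabulate : ∀ {A : Set} {n} (d : A) (g : ℕ → A) m → m < n →
                    lookupOr d (Vec.tabulate {n = n} (λ f → g (toℕ f))) m ≡ g m
lookupOr-tabulate {n = suc n} d g zero _ = refl
lookupOr-tabulate {n = suc n} d g (suc m) (s≤s m<n) = lookupOr-tabulate {n = n} d (λ x → g (suc x)) m m<n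

lookupOr-true⇒index : ∀ {n} (xs : Vec Bool n) m → lookupOr false xs m ≡ true → Σ (Fin n) λ f → toℕ f ≡ m
lookupOr-true⇒index (x ∷ xs) zero _ = fzero , refl
lookupOr-true⇒index (x ∷ xs) (suc m) e = Product.map fsuc (cong suc) (lookupOr-true⇒index xs m e)

sAt≡lookupOr : ∀ {n} (s : Vec ℕ n) m → sAt s (suc m) ≡ lookupOr 0 s m
sAt≡lookupOr [] m = refl
sAt≡lookupOr (x ∷ xs) zero = refl
sAt≡lookupOr (x ∷ []) (suc m) = refl
sAt≡lookupOr (x ∷ y ∷ ys) (suc m) = sAt≡lookupOr (y ∷ ys) m

sAt-lookup : ∀ {n} (s : Vec ℕ n) (f : Fin n) → sAt s (suc (toℕ f)) ≡ lookup s f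
sAt-lookup s f = trans (sAt≡lookupOr s (toℕ f)) (lookupOr-toℕ 0 s f)

-- The subset A as an indicator on labels: label k + 1 stands for k : Fin n.
labelIndicator : ∀ {n} → Subset n → ℕ → Bool
labelIndicator A zero = false
labelIndicator A (suc m) = lookupOr false A m

labelIndicator-lookup : ∀ {n} (A : Subset n) (f : Fin n) → labelIndicator A (suc (toℕ f)) ≡ lookup A f
labelIndicator-lookup A f = lookupOr-toℕ false A f

∈ₛ⇒lookup : ∀ {n} {A : Subset n} {f} → f ∈ₛ A → lookup A f ≡ true
∈ₛ⇒lookup = []=⇒lookup

lookup⇒∈ₛ : ∀ {n} {A : Subset n} {f} → lookup A f ≡ true → f ∈ₛ A
lookup⇒∈ₛ {A = A} {f} = lookup⇒[]= f A

Subset-ext : ∀ {n} (A B : Subset n) → (∀ f → lookup A f ≡ true → lookup B f ≡ true) →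
             (∀ f → lookup B f ≡ true → lookup A f ≡ true) → A ≡ B
Subset-ext A B A⊆B B⊆A = trans (sym (tabulate∘lookup A))
  (trans (Vec-tabulate-cong (λ f → Bool-≡-from-⇔ (A⊆B f) (B⊆A f))) (tabulate∘lookup B))

toℕ<n : ∀ {m} (f : Fin m) → suc (toℕ f) ≤ m
toℕ<n fzero = s≤s z≤n
toℕ<n (fsuc f) = s≤s (toℕ<n f)

module JoinArcs (n : ℕ) (s : Vec ℕ n) where
  private σ = sAt s
  open STrees n s
  open WeakOrder n s

  module _ (α : Arc n s) where
    open Arc α

    arcA : ℕ → Bool
    arcA = labelIndicator A

    arcA-range : ∀ b → arcA b ≡ true → i < b × b < j × σ b ≢ 0
    arcA-range (suc m) e with lookupOr-true⇒index A m e
    ... | f , refl with cover→ f (inj₁ (lookup⇒∈ₛ (trans (sym (labelIndicator-lookup A f)) e)))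
    ...   | i<b , b<j , s≢0 = i<b , b<j , subst (_≢ 0) (sym (sAt-lookup s f)) s≢0

    module J∨ = JoinTree n s i j r arcA 1≤i i<j j≤n 1≤r r≤s arcA-range

    inner-lookup : ∀ f → (lookup A f ∨ (suc (toℕ f) ≡ᵇ j)) ≡ J∨.inner (suc (toℕ f))
    inner-lookup f rewrite labelIndicator-lookup A f = refl

    Tjoin≡T∨ : Tjoin α ≡ J∨.T∨
    Tjoin≡T∨
      rewrite labelsWhere-filterBy n (λ k → lookup A k ∨ (suc (toℕ k) ≡ᵇ j)) J∨.inner inner-lookup
            | labelsWhere-filterBy n (λ k → not (lookup A k ∨ (suc (toℕ k) ≡ᵇ j))) J∨.outer (cong not ∘ inner-lookup)
      = Combs.graft-rightComb σ i r J∨.I J∨.O J∨.O-ascending J∨.i∈O 1≤r r≤s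

    Tjoin-sTree : IsSTree n s (Tjoin α)
    Tjoin-sTree = subst (IsSTree n s) (sym Tjoin≡T∨) J∨.T∨-sTree

    Tjoin-joinIrreducible : JoinIrreducible n s (Tjoin α)
    Tjoin-joinIrreducible = subst (JoinIrreducible n s) (sym Tjoin≡T∨) J∨.T∨-joinIrreducible

  private
    pos-Tjoin : ∀ (α : Arc n s) a b → pos s (Tjoin α) a b ≡ pos s (J∨.T∨ α) a b
    pos-Tjoin α a b = cong (λ t → pos s t a b) (Tjoin≡T∨ α)

    seen-from-i : ∀ (α β : Arc n s) → Tjoin α ≡ Tjoin β → ∀ {b} → b ∈ J∨.I α →
                  b ∈ J∨.I β × (Arc.i α ≡ Arc.i β ⊎ (Arc.i β < Arc.i α × Arc.i α ∈ J∨.O β))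
    seen-from-i α β e {b} b∈ with J∨.∈I⇒range α b∈
    ... | i<b , _ , b≤n = J∨.pos-T∨-nonzero β (Arc.i α) b (Arc.1≤i α) i<b b≤n nonzero
      where
      nonzero : pos s (J∨.T∨ β) (Arc.i α) b ≢ 0
      nonzero z = <-irrefl (sym (begin
        Arc.r α                       ≡⟨ J∨.pos-T∨-i-I α b b∈ ⟨
        pos s (J∨.T∨ α) (Arc.i α) b   ≡⟨ pos-Tjoin α _ b ⟨
        pos s (Tjoin α) (Arc.i α) b   ≡⟨ cong (λ t → pos s t (Arc.i α) b) e ⟩
        pos s (Tjoin β) (Arc.i α) b   ≡⟨ pos-Tjoin β _ b ⟩
        pos s (J∨.T∨ β) (Arc.i α) b   ≡⟨ z ⟩
        0                             ∎)) (Arc.1≤r α)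
        where open ≡-Reasoning

    A⊆ : ∀ (α β : Arc n s) → Tjoin α ≡ Tjoin β → Arc.j α ≡ Arc.j β →
         ∀ f → lookup (Arc.A α) f ≡ true → lookup (Arc.A β) f ≡ true
    A⊆ α β e j≡ f f∈A with J∨.∈I⇒∈Aₗ⊎≡j β (proj₁ (seen-from-i α β e b∈I))
      where
      b = suc (toℕ f)
      Ab : arcA α b ≡ true
      Ab = trans (labelIndicator-lookup (Arc.A α) f) f∈A
      b∈I = J∨.∈Aₗ⇒∈I α (∈-filterBy⁺ (arcA α) (J∨.allLabels α) (J∨.∈-allLabels⁺ α (s≤s z≤n) (toℕ<n f)) Ab)
    ... | inj₁ b∈A = trans (sym (labelIndicator-lookup (Arc.A β) f)) (proj₂ (∈-filterBy⁻ (arcA β) (J∨.allLabels β) b∈A))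
    ... | inj₂ b≡j with arcA-range α _ (trans (labelIndicator-lookup (Arc.A α) f) f∈A)
    ...   | _ , b<j , _ = ⊥-elim (<-irrefl (trans b≡j (sym j≡)) b<j)

    B⊆ : ∀ (α β : Arc n s) → Arc.i α ≡ Arc.i β → Arc.j α ≡ Arc.j β → Arc.A α ≡ Arc.A β →
         ∀ f → lookup (Arc.B α) f ≡ true → lookup (Arc.B β) f ≡ true
    B⊆ α β i≡ j≡ A≡ f f∈B with Arc.cover→ α f (inj₂ (lookup⇒∈ₛ f∈B))
    ... | i<b , b<j , s≢0 with Arc.cover← β f (subst (_< suc (toℕ f)) i≡ i<b , subst (suc (toℕ f) <_) j≡ b<j , s≢0)
    ...   | inj₂ f∈Bβ = ∈ₛ⇒lookup f∈Bβ
    ...   | inj₁ f∈Aβ = ⊥-elim (Arc.disjoint α f (lookup⇒∈ₛ (trans (cong (λ v → lookup v f) A≡) (∈ₛ⇒lookup f∈Aβ)) ,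
                                                  lookup⇒∈ₛ f∈B))

  Tjoin-injective : ∀ (α β : Arc n s) → Tjoin α ≡ Tjoin β → SameArc α β
  Tjoin-injective α β e = i≡ , j≡ , A≡ , B≡ , r≡
    where
    module α = Arc α
    module β = Arc β
    i≡ : α.i ≡ β.i
    i≡ with proj₂ (seen-from-i α β e (J∨.j∈I α)) | proj₂ (seen-from-i β α (sym e) (J∨.j∈I β))
    ... | inj₁ i≡ | _ = i≡
    ... | inj₂ _ | inj₁ i≡ = sym i≡
    ... | inj₂ (βi<αi , _) | inj₂ (αi<βi , _) = ⊥-elim (<-asym βi<αi αi<βi)
    j≡ : α.j ≡ β.j
    j≡ = ≤-antisym (proj₁ (proj₂ (J∨.∈I⇒range β (proj₁ (seen-from-i α β e (J∨.j∈I α))))))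
                   (proj₁ (proj₂ (J∨.∈I⇒range α (proj₁ (seen-from-i β α (sym e) (J∨.j∈I β))))))
    r≡ : α.r ≡ β.r
    r≡ = begin
      α.r                           ≡⟨ J∨.pos-T∨-ij α ⟨
      pos s (J∨.T∨ α) α.i α.j       ≡⟨ pos-Tjoin α α.i α.j ⟨
      pos s (Tjoin α) α.i α.j       ≡⟨ cong (λ t → pos s t α.i α.j) e ⟩
      pos s (Tjoin β) α.i α.j       ≡⟨ cong₂ (pos s (Tjoin β)) i≡ j≡ ⟩
      pos s (Tjoin β) β.i β.j       ≡⟨ pos-Tjoin β β.i β.j ⟩
      pos s (J∨.T∨ β) β.i β.j       ≡⟨ J∨.pos-T∨-ij β ⟩
      β.r                           ∎
      where open ≡-Reasoning
    A≡ : α.A ≡ β.A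
    A≡ = Subset-ext α.A β.A (A⊆ α β e j≡) (A⊆ β α (sym e) (sym j≡))
    B≡ : α.B ≡ β.B
    B≡ = Subset-ext α.B β.B (B⊆ α β i≡ j≡ A≡) (B⊆ β α (sym i≡) (sym j≡) (sym A≡))

  -- The arc read off from an s-tree t at a pair (i, j) with pos t (i, j) = r ≥ 1:
  -- A (resp. B) collects the b ∈ ]i, j[ with s_b ≠ 0 that i sees at least as
  -- far left as j (resp. strictly further right).
  module ArcAt {t : Tree} (st : IsSTree n s t) (i j : ℕ) (1≤i : 1 ≤ i) (i<j : i < j) (j≤n : j ≤ n)
               (1≤r : 1 ≤ pos s t i j) where
    r = pos s t i j

    inRange leftOf-j inA inB : ℕ → Bool
    inRange b = (i <ᵇ b) ∧ ((b <ᵇ j) ∧ not (σ b ≡ᵇ 0))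
    leftOf-j b = r ≤ᵇ pos s t i b
    inA b = inRange b ∧ leftOf-j b
    inB b = inRange b ∧ not (leftOf-j b)

    inRange⇒ : ∀ {b} → inRange b ≡ true → i < b × b < j × σ b ≢ 0
    inRange⇒ {b} e with ∧-true-split (i <ᵇ b) _ e
    ... | i<b , rest with ∧-true-split (b <ᵇ j) _ rest
    ...   | b<j , σb≢0 = <ᵇ-true⇒< i<b , <ᵇ-true⇒< b<j , ≡ᵇ-false⇒≢ (σ b) 0 (trans (sym (not-involutive _)) (cong not σb≢0))

    ⇒inRange : ∀ {b} → i < b → b < j → σ b ≢ 0 → inRange b ≡ true
    ⇒inRange i<b b<j σb≢0 rewrite <⇒<ᵇ-true i<b | <⇒<ᵇ-true b<j | ≢⇒≡ᵇ-false _ 0 σb≢0 = refl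

    A B : Subset n
    A = Vec.tabulate (λ f → inA (suc (toℕ f)))
    B = Vec.tabulate (λ f → inB (suc (toℕ f)))

    lookup-A : ∀ f → lookup A f ≡ inA (suc (toℕ f))
    lookup-A = lookup∘tabulate _
    lookup-B : ∀ f → lookup B f ≡ inB (suc (toℕ f))
    lookup-B = lookup∘tabulate _

    ∈A⇒ : ∀ {f} → f ∈ₛ A → inRange (suc (toℕ f)) ≡ true × leftOf-j (suc (toℕ f)) ≡ true
    ∈A⇒ {f} f∈A = ∧-true-split (inRange (suc (toℕ f))) (leftOf-j (suc (toℕ f))) (trans (sym (lookup-A f)) (∈ₛ⇒lookup f∈A))

    ∈B⇒ : ∀ {f} → f ∈ₛ B → inRange (suc (toℕ f)) ≡ true × not (leftOf-j (suc (toℕ f))) ≡ true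
    ∈B⇒ {f} f∈B = ∧-true-split (inRange (suc (toℕ f))) (not (leftOf-j (suc (toℕ f)))) (trans (sym (lookup-B f)) (∈ₛ⇒lookup f∈B))

    ∈ₛ⇒inRange : ∀ {f} → f ∈ₛ A ⊎ f ∈ₛ B → inRange (suc (toℕ f)) ≡ true
    ∈ₛ⇒inRange (inj₁ f∈A) = proj₁ (∈A⇒ f∈A)
    ∈ₛ⇒inRange (inj₂ f∈B) = proj₁ (∈B⇒ f∈B)

    arc : Arc n s
    arc = record
      { i = i ; j = j ; 1≤i = 1≤i ; i<j = i<j ; j≤n = j≤n ; A = A ; B = B
      ; disjoint = λ f (f∈A , f∈B) →
          true≢false (proj₂ (∈A⇒ f∈A)) (trans (sym (not-involutive _)) (cong not (proj₂ (∈B⇒ f∈B))))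
      ; cover→ = λ f f∈ → Product.map₂ (Product.map₂ (subst (_≢ 0) (sAt-lookup s f))) (inRange⇒ (∈ₛ⇒inRange f∈))
      ; cover← = cover←
      ; r = r ; 1≤r = 1≤r ; r≤s = m⊓n≤m (σ i) _ }
      where
      cover← : ∀ f → i < suc (toℕ f) × suc (toℕ f) < j × lookup s f ≢ 0 → f ∈ₛ A ⊎ f ∈ₛ B
      cover← f (i<b , b<j , s≢0) with ⇒inRange i<b b<j (subst (_≢ 0) (sym (sAt-lookup s f)) s≢0)
                                      | leftOf-j (suc (toℕ f)) in e
      ... | in-range | true  = inj₁ (lookup⇒∈ₛ (trans (lookup-A f) (cong₂ _∧_ in-range e)))
      ... | in-range | false = inj₂ (lookup⇒∈ₛ (trans (lookup-B f) (cong₂ _∧_ in-range (cong not e))))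

    module J = J∨ arc

    arcA≡inA : ∀ b → 1 ≤ b → b ≤ n → arcA arc b ≡ inA b
    arcA≡inA (suc m) _ m<n = lookupOr-tabulate false (λ x → inA (suc x)) m m<n

    Tjoin-below : Tjoin arc ≤[ s ] t
    Tjoin-below = subst (_≤[ s ] t) (sym (Tjoin≡T∨ arc)) (J.T∨-below t at-i right-of-i)
      where
      at-i : ∀ b → b ∈ J.I → r ≤ pos s t i b
      at-i b b∈ with J.∈I⇒∈Aₗ⊎≡j b∈
      ... | inj₂ refl = ≤-refl
      ... | inj₁ b∈A with ∈-filterBy⁻ (arcA arc) J.allLabels b∈A
      ...   | b∈all , Ab with J.∈-allLabels⁻ b∈all
      ...     | 1≤b , b≤n = ≤ᵇ⇒≤ r _ (Equivalence.from T-≡ (proj₂ (∧-true-split _ _ (trans (sym (arcA≡inA b 1≤b b≤n)) Ab))))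
      right-of-i : ∀ a b → a ∈ J.O → i < a → a < b → b ∈ J.I → σ a ≤ pos s t a b
      right-of-i a b a∈ i<a a<b b∈ with σ a ≟ 0
      ... | yes σa≡0 rewrite σa≡0 = z≤n
      ... | no σa≢0 = ≤-reflexive (sym (pos-planarity t st i a b 1≤i i<a a<b b≤n (<-≤-trans ia<r (at-i b b∈))))
        where
        b≤n = proj₂ (proj₂ (J.∈I⇒range b∈))
        a<j = <-≤-trans a<b (proj₁ (proj₂ (J.∈I⇒range b∈)))
        ¬inA : inA a ≡ false
        ¬inA = trans (sym (arcA≡inA a (≤-trans 1≤i (<⇒≤ i<a)) (≤-trans (<⇒≤ a<b) b≤n)))
                     (∨-conicalˡ (arcA arc a) _ (J.∈O⇒¬inner a∈))
        ia<r : pos s t i a < r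
        ia<r = ≰⇒> (λ r≤ → true≢false (cong₂ _∧_ (⇒inRange i<a a<j σa≢0) (Equivalence.to T-≡ (≤⇒≤ᵇ r≤))) ¬inA)

  -- The arc read off at a pair separating t from its lower cover has T_∨ ≤ t;
  -- were T_∨ ≠ t it would lie below the lower cover, which it does not at that pair.
  Tjoin-surjective : ∀ t → IsSTree n s t → JoinIrreducible n s t → ∃ λ α → Tjoin α ≡ t
  Tjoin-surjective t st (u , (su , cover@(u≤t , u≢t , _)) , unique)
    with strictly-below⇒separating-pair su st u≤t u≢t
  ... | i , j , 1≤i , i<j , j≤n , u<t = arc , Tjoin≡t
    where
    open ArcAt st i j 1≤i i<j j≤n (≤-trans (s≤s z≤n) u<t)
    Tjoin≡t : Tjoin arc ≡ t
    Tjoin≡t with tree-≟ (Tjoin arc) t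
    ... | yes e = e
    ... | no ne = ⊥-elim (below-joinIrreducible st su cover unique (Tjoin arc) (Tjoin-sTree arc) Tjoin-below ne
                    (λ T≤u → <⇒≱ u<t (subst (_≤ pos s u i j) pos-Tjoin-ij (T≤u i j 1≤i i<j j≤n))))
      where
      pos-Tjoin-ij : pos s (Tjoin arc) i j ≡ r
      pos-Tjoin-ij = trans (cong (λ t′ → pos s t′ i j) (Tjoin≡T∨ arc)) (J∨.pos-T∨-ij arc)

mutual
  mirror : Tree → Tree
  mirror leaf = leaf
  mirror (node k cs) = node k (mirrorL cs)

  mirrorL : List Tree → List Tree
  mirrorL [] = []
  mirrorL (c ∷ cs) = mirrorL cs ++ mirror c ∷ []

mirrorL-++ : ∀ xs ys → mirrorL (xs ++ ys) ≡ mirrorL ys ++ mirrorL xs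
mirrorL-++ [] ys = sym (++-identityʳ _)
mirrorL-++ (x ∷ xs) ys rewrite mirrorL-++ xs ys = ++-assoc (mirrorL ys) (mirrorL xs) _

mutual
  mirror-involutive : ∀ t → mirror (mirror t) ≡ t
  mirror-involutive leaf = refl
  mirror-involutive (node k cs) = cong (node k) (mirrorL-involutive cs)

  mirrorL-involutive : ∀ cs → mirrorL (mirrorL cs) ≡ cs
  mirrorL-involutive [] = refl
  mirrorL-involutive (c ∷ cs)
    rewrite mirrorL-++ (mirrorL cs) (mirror c ∷ []) | mirror-involutive c | mirrorL-involutive cs = refl

mirror-injective : ∀ {t u} → mirror t ≡ mirror u → t ≡ u
mirror-injective {t} {u} e = trans (sym (mirror-involutive t)) (trans (cong mirror e) (mirror-involutive u))

length-mirrorL : ∀ cs → length (mirrorL cs) ≡ length cs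
length-mirrorL [] = refl
length-mirrorL (c ∷ cs) rewrite length-++ (mirrorL cs) {mirror c ∷ []} | length-mirrorL cs = +-comm (length cs) 1

mirrorL-leaves : ∀ m → mirrorL (replicate m leaf) ≡ replicate m leaf
mirrorL-leaves zero = refl
mirrorL-leaves (suc m) rewrite mirrorL-leaves m = replicate-snoc m
  where
  replicate-snoc : ∀ m → replicate m leaf ++ leaf ∷ [] ≡ leaf ∷ replicate m leaf
  replicate-snoc zero = refl
  replicate-snoc (suc m) = cong (leaf ∷_) (replicate-snoc m)

occursL-++ : ∀ b xs ys → occursL b (xs ++ ys) ≡ occursL b xs ∨ occursL b ys
occursL-++ b [] ys = refl
occursL-++ b (x ∷ xs) ys rewrite occursL-++ b xs ys = sym (∨-assoc (occurs b x) _ _)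

mutual
  occurs-mirror : ∀ b t → occurs b (mirror t) ≡ occurs b t
  occurs-mirror b leaf = refl
  occurs-mirror b (node k cs) rewrite occursL-mirror b cs = refl

  occursL-mirror : ∀ b cs → occursL b (mirrorL cs) ≡ occursL b cs
  occursL-mirror b [] = refl
  occursL-mirror b (c ∷ cs)
    rewrite occursL-++ b (mirrorL cs) (mirror c ∷ []) | occursL-mirror b cs | occurs-mirror b c
          | ∨-identityʳ (occurs b c) = ∨-comm (occursL b cs) (occurs b c)

degreeL-++ : ∀ a xs ys → degreeL a (xs ++ ys) ≡ degreeL a xs + degreeL a ys
degreeL-++ a [] ys = refl
degreeL-++ a (x ∷ xs) ys rewrite degreeL-++ a xs ys = sym (+-assoc (degree a x) _ _)

mutual
  degree-mirror : ∀ a t → degree a (mirror t) ≡ degree a t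
  degree-mirror a leaf = refl
  degree-mirror a (node k cs) with k ≡ᵇ a
  ... | true  = length-mirrorL cs
  ... | false = degreeL-mirror a cs

  degreeL-mirror : ∀ a cs → degreeL a (mirrorL cs) ≡ degreeL a cs
  degreeL-mirror a [] = refl
  degreeL-mirror a (c ∷ cs)
    rewrite degreeL-++ a (mirrorL cs) (mirror c ∷ []) | degreeL-mirror a cs | degree-mirror a c
          | +-identityʳ (degree a c) = +-comm (degreeL a cs) (degree a c)

rightEdgesL-++ˡ : ∀ a b xs ys → occursL b xs ≡ true → rightEdgesL a b (xs ++ ys) ≡ rightEdgesL a b xs + degreeL a ys
rightEdgesL-++ˡ a b (x ∷ xs) ys e with occurs b x
... | true rewrite degreeL-++ a xs ys = sym (+-assoc (rightEdges a b x) _ _)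
... | false = rightEdgesL-++ˡ a b xs ys e

rightEdgesL-++ʳ : ∀ a b xs ys → occursL b xs ≡ false → rightEdgesL a b (xs ++ ys) ≡ rightEdgesL a b ys
rightEdgesL-++ʳ a b [] ys e = refl
rightEdgesL-++ʳ a b (x ∷ xs) ys e with ∨-false-split (occurs b x) (occursL b xs) e
... | e₁ , e₂ rewrite e₁ = rightEdgesL-++ʳ a b xs ys e₂

countAfter-++ˡ : ∀ b xs ys → occursL b xs ≡ true → countAfter b (xs ++ ys) ≡ countAfter b xs + length ys
countAfter-++ˡ b (x ∷ xs) ys e with occurs b x
... | true  = length-++ xs
... | false = countAfter-++ˡ b xs ys e

countAfter-++ʳ : ∀ b xs ys → occursL b xs ≡ false → countAfter b (xs ++ ys) ≡ countAfter b ys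
countAfter-++ʳ b [] ys e = refl
countAfter-++ʳ b (x ∷ xs) ys e with ∨-false-split (occurs b x) (occursL b xs) e
... | e₁ , e₂ rewrite e₁ = countAfter-++ʳ b xs ys e₂

countAfter-mirrorL : ∀ b cs → DistinctLabelsL cs → occursL b cs ≡ true →
                     countAfter b (mirrorL cs) + countAfter b cs + 1 ≡ length cs
countAfter-mirrorL b (c ∷ cs) (_ , d , disj) e with occurs b c in ebc
... | true rewrite countAfter-++ʳ b (mirrorL cs) (mirror c ∷ []) (trans (occursL-mirror b cs) (disj b ebc))
                 | occurs-mirror b c | ebc = +-comm (length cs) 1
... | false rewrite countAfter-++ˡ b (mirrorL cs) (mirror c ∷ []) (trans (occursL-mirror b cs) e) =
  trans (cong (_+ 1) (trans (+-assoc (countAfter b (mirrorL cs)) 1 (countAfter b cs))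
                            (+-suc (countAfter b (mirrorL cs)) (countAfter b cs))))
        (cong suc (countAfter-mirrorL b cs d e))

mutual
  labels-mirror : ∀ t → labels (mirror t) ↭ labels t
  labels-mirror leaf = ↭-refl
  labels-mirror (node k cs) = prep k (labelsL-mirror cs)

  labelsL-mirror : ∀ cs → labelsL (mirrorL cs) ↭ labelsL cs
  labelsL-mirror [] = ↭-refl
  labelsL-mirror (c ∷ cs) rewrite labelsL-++ (mirrorL cs) (mirror c ∷ []) | ++-identityʳ (labels (mirror c)) =
    ↭-trans (++⁺ʳ (labels (mirror c)) (labelsL-mirror cs))
      (↭-trans (++⁺ˡ (labelsL cs) (labels-mirror c)) (++-comm (labelsL cs) (labels c)))

mutual
  WF-mirror : ∀ σ t → WF σ t → WF σ (mirror t)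
  WF-mirror σ leaf _ = tt
  WF-mirror σ (node k cs) (len , ab , wl) = trans (length-mirrorL cs) len , AboveL-mirror k cs ab , WFL-mirror σ cs wl

  WFL-mirror : ∀ σ cs → WFL σ cs → WFL σ (mirrorL cs)
  WFL-mirror σ [] _ = tt
  WFL-mirror σ (c ∷ cs) (w₁ , w₂) = WFL-++ σ (mirrorL cs) (mirror c ∷ []) (WFL-mirror σ cs w₂) (WF-mirror σ c w₁ , tt)

  AboveL-mirror : ∀ k cs → AboveL k cs → AboveL k (mirrorL cs)
  AboveL-mirror k [] _ = tt
  AboveL-mirror k (c ∷ cs) (a₁ , a₂) =
    AboveL-++ k (mirrorL cs) (mirror c ∷ []) (AboveL-mirror k cs a₂) (Above-mirror k c a₁ , tt)

  Above-mirror : ∀ k c → Above k c → Above k (mirror c)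
  Above-mirror k leaf a = a
  Above-mirror k (node _ _) a = a

mirror-rightComb : ∀ σ L → mirror (rightComb σ L) ≡ leftComb σ L
mirror-rightComb σ [] = refl
mirror-rightComb σ (l ∷ L)
  rewrite mirrorL-++ (replicate (σ l) leaf) (rightComb σ L ∷ []) | mirrorL-leaves (σ l) | mirror-rightComb σ L = refl

setAt-++ˡ : ∀ q Y xs ys → q < length xs → setAt q Y (xs ++ ys) ≡ setAt q Y xs ++ ys
setAt-++ˡ zero Y (x ∷ xs) ys _ = refl
setAt-++ˡ (suc q) Y (x ∷ xs) ys (s≤s q<) = cong (x ∷_) (setAt-++ˡ q Y xs ys q<)

setAt-last : ∀ Y xs y → setAt (length xs) Y (xs ++ y ∷ []) ≡ xs ++ Y ∷ []
setAt-last Y [] y = refl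
setAt-last Y (x ∷ xs) y = cong (x ∷_) (setAt-last Y xs y)

mirrorL-setAt : ∀ p X cs → p < length cs →
                mirrorL (setAt p X cs) ≡ setAt (length cs ∸ suc p) (mirror X) (mirrorL cs)
mirrorL-setAt zero X (c ∷ cs) _ =
  sym (trans (cong (λ q → setAt q (mirror X) (mirrorL cs ++ mirror c ∷ [])) (sym (length-mirrorL cs)))
             (setAt-last (mirror X) (mirrorL cs) (mirror c)))
mirrorL-setAt (suc p) X (c ∷ cs) (s≤s p<) rewrite mirrorL-setAt p X cs p< =
  sym (setAt-++ˡ (length cs ∸ suc p) (mirror X) (mirrorL cs) (mirror c ∷ [])
        (subst (length cs ∸ suc p <_) (sym (length-mirrorL cs)) (∸-monoʳ-< (s≤s z≤n) p<)))

graftL-++ : ∀ i m X xs ys → graftL i m X (xs ++ ys) ≡ graftL i m X xs ++ graftL i m X ys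
graftL-++ i m X [] ys = refl
graftL-++ i m X (x ∷ xs) ys = cong (_ ∷_) (graftL-++ i m X xs ys)

-- The (m+1)-st edge of i from the right becomes the (σ i + 1 − m)-th.
module _ (σ : ℕ → ℕ) (i m : ℕ) (X : Tree) where
  mutual
    mirror-graft : ∀ t → WF σ t → mirror (graft i m X t) ≡ graft i (σ i ∸ m) (mirror X) (mirror t)
    mirror-graft leaf _ = refl
    mirror-graft (node k cs) (len , _ , wl) with k ≡ᵇ i in k≡ᵇi
    ... | true with ≡ᵇ-true⇒≡ k i k≡ᵇi
    ...   | refl = cong (node k)
      (trans (cong (λ l → mirrorL (setAt (l ∸ suc m) X cs)) len)
        (trans (mirrorL-setAt (σ k ∸ m) X cs (subst (σ k ∸ m <_) (sym len) (s≤s (m∸n≤m (σ k) m))))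
          (cong (λ l → setAt (l ∸ suc (σ k ∸ m)) (mirror X) (mirrorL cs)) (sym (length-mirrorL cs)))))
    mirror-graft (node k cs) (len , _ , wl) | false = cong (node k) (mirrorL-graftL cs wl)

    mirrorL-graftL : ∀ cs → WFL σ cs → mirrorL (graftL i m X cs) ≡ graftL i (σ i ∸ m) (mirror X) (mirrorL cs)
    mirrorL-graftL [] _ = refl
    mirrorL-graftL (c ∷ cs) (w₁ , w₂) rewrite mirrorL-graftL cs w₂ | mirror-graft c w₁ =
      sym (graftL-++ i (σ i ∸ m) (mirror X) (mirrorL cs) (mirror c ∷ []))

-- Meet irreducibles by symmetry

module Meets (n : ℕ) (s : Vec ℕ n) where
  private σ = sAt s
  open WellFormed σ
  open STrees n s
  open JoinArcs n s

  -- Mirroring turns the edges of a right of the path to b into those left of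
  -- it, hence pos into its complement s_a − pos.
  mutual
    pos-mirror : ∀ a b t → WF σ t → DistinctLabels t → a < b → occurs a t ≡ true → occurs b t ≡ true →
                 σ a ⊓ rightEdges a b (mirror t) ≡ σ a ∸ (σ a ⊓ rightEdges a b t)
    pos-mirror a b (node k cs) w@(len , _ , wl) (_ , dl) a<b ea eb with k ≡ᵇ a in k≡ᵇa
    ... | true with ≡ᵇ-true⇒≡ k a k≡ᵇa
    ...   | refl rewrite ≢⇒≡ᵇ-false k b (<⇒≢ a<b) = begin
      σ k ⊓ y         ≡⟨ m≥n⇒m⊓n≡n y≤σk ⟩
      y               ≡⟨ m+n∸n≡m y x ⟨
      y + x ∸ x       ≡⟨ cong (_∸ x) y+x≡σk ⟩
      σ k ∸ x         ≡⟨ cong (σ k ∸_) (m≥n⇒m⊓n≡n x≤σk) ⟨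
      σ k ∸ (σ k ⊓ x) ∎
      where
      open ≡-Reasoning
      x = countAfter b cs
      y = countAfter b (mirrorL cs)
      y+x≡σk : y + x ≡ σ k
      y+x≡σk = suc-injective (trans (+-comm 1 (y + x)) (trans (countAfter-mirrorL b cs dl eb) len))
      x≤σk : x ≤ σ k
      x≤σk = subst (x ≤_) y+x≡σk (m≤n+m x y)
      y≤σk : y ≤ σ k
      y≤σk = subst (y ≤_) y+x≡σk (m≤m+n y x)
    pos-mirror a b (node k cs) w@(len , _ , wl) (_ , dl) a<b ea eb | false
      with root-minimal k cs w a (occurs-child k a cs ea)
    ... | k≤a rewrite ≢⇒≡ᵇ-false k b (<⇒≢ (≤-<-trans k≤a a<b)) = pos-mirrorL a b cs wl dl a<b ea eb

    pos-mirrorL : ∀ a b cs → WFL σ cs → DistinctLabelsL cs → a < b → occursL a cs ≡ true → occursL b cs ≡ true →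
                  σ a ⊓ rightEdgesL a b (mirrorL cs) ≡ σ a ∸ (σ a ⊓ rightEdgesL a b cs)
    pos-mirrorL a b (c ∷ cs) (w₁ , w₂) (d₁ , d₂ , disj) a<b ea eb with occurs b c in ebc
    ... | true rewrite rightEdgesL-++ʳ a b (mirrorL cs) (mirror c ∷ []) (trans (occursL-mirror b cs) (disj b ebc))
                     | occurs-mirror b c | ebc | +-identityʳ (rightEdges a b (mirror c)) with occurs a c in eac
    ...   | true rewrite degreeL-absent a cs (disj a eac) | +-identityʳ (rightEdges a b c) =
      pos-mirror a b c w₁ d₁ a<b eac ebc
    ...   | false rewrite rightEdges-absent a b (mirror c) (trans (occurs-mirror a c) eac) | rightEdges-absent a b c eac
                        | degreeL-present a cs w₂ d₂ ea | ⊓-zeroʳ (σ a) | m≤n⇒m⊓n≡m (n≤1+n (σ a)) =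
      sym (n∸n≡0 (σ a))
    pos-mirrorL a b (c ∷ cs) (w₁ , w₂) (d₁ , d₂ , disj) a<b ea eb | false
      rewrite rightEdgesL-++ˡ a b (mirrorL cs) (mirror c ∷ []) (trans (occursL-mirror b cs) eb)
            | degree-mirror a c with occurs a c in eac
    ... | true rewrite rightEdgesL-absent a b (mirrorL cs) (trans (occursL-mirror a cs) (disj a eac))
                     | rightEdgesL-absent a b cs (disj a eac) | degree-present a c w₁ d₁ eac | ⊓-zeroʳ (σ a)
                     | +-identityʳ (suc (σ a)) = m≤n⇒m⊓n≡m (n≤1+n (σ a))
    ... | false rewrite degree-absent a c eac | +-identityʳ (rightEdgesL a b (mirrorL cs)) =
      pos-mirrorL a b cs w₂ d₂ a<b ea eb

  mirror-sTree : ∀ {t} → IsSTree n s t → IsSTree n s (mirror t)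
  mirror-sTree {t} st = ↭-trans (labels-mirror t) (proj₁ st) , WF-mirror σ t (proj₂ st)

  pos-mirror-sTree : ∀ {t} → IsSTree n s t → ∀ a b → 1 ≤ a → a < b → b ≤ n → pos s (mirror t) a b ≡ σ a ∸ pos s t a b
  pos-mirror-sTree {t} st a b 1≤a a<b b≤n = pos-mirror a b t (proj₂ st) (sTree-distinct st) a<b
    (sTree-occurs⁺ st a 1≤a (≤-trans (<⇒≤ a<b) b≤n)) (sTree-occurs⁺ st b (≤-trans 1≤a (<⇒≤ a<b)) b≤n)

  mirror-antitone : ∀ {t t′} → IsSTree n s t → IsSTree n s t′ → t ≤[ s ] t′ → mirror t′ ≤[ s ] mirror t
  mirror-antitone st st′ t≤t′ a b 1≤a a<b b≤n
    rewrite pos-mirror-sTree st′ a b 1≤a a<b b≤n | pos-mirror-sTree st a b 1≤a a<b b≤n =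
    ∸-monoʳ-≤ (σ a) (t≤t′ a b 1≤a a<b b≤n)

  mirror-antitone⁻ : ∀ {t t′} → IsSTree n s t → IsSTree n s t′ → mirror t ≤[ s ] mirror t′ → t′ ≤[ s ] t
  mirror-antitone⁻ {t} {t′} st st′ m≤m′ =
    subst₂ (λ x y → x ≤[ s ] y) (mirror-involutive t′) (mirror-involutive t)
           (mirror-antitone (mirror-sTree st) (mirror-sTree st′) m≤m′)

  Covers-mirror : ∀ {t′ t} → IsSTree n s t′ → IsSTree n s t → Covers n s t′ t → Covers n s (mirror t) (mirror t′)
  Covers-mirror {t′} {t} st′ st (t≤t′ , t≢t′ , between) =
    mirror-antitone st st′ t≤t′ , (λ e → t≢t′ (mirror-injective (sym e))) , between-mirror
    where
    between-mirror : ∀ w → IsSTree n s w → mirror t′ ≤[ s ] w → w ≤[ s ] mirror t → w ≡ mirror t′ ⊎ w ≡ mirror t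
    between-mirror w sw m′≤w w≤m with between (mirror w) (mirror-sTree sw)
      (mirror-antitone⁻ (mirror-sTree sw) st (subst (_≤[ s ] mirror t) (sym (mirror-involutive w)) w≤m))
      (mirror-antitone⁻ st′ (mirror-sTree sw) (subst (mirror t′ ≤[ s ]_) (sym (mirror-involutive w)) m′≤w))
    ... | inj₁ e = inj₂ (trans (sym (mirror-involutive w)) (cong mirror e))
    ... | inj₂ e = inj₁ (trans (sym (mirror-involutive w)) (cong mirror e))

  joinIrreducible⇒meetIrreducible : ∀ {t} → IsSTree n s t → JoinIrreducible n s t → MeetIrreducible n s (mirror t)
  joinIrreducible⇒meetIrreducible {t} st (u , (su , cover) , unique) =
    mirror u , (mirror-sTree su , Covers-mirror st su cover) , λ v sv c →
      trans (sym (mirror-involutive v)) (cong mirror (unique (mirror v) (mirror-sTree sv)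
        (subst (λ z → Covers n s z (mirror v)) (mirror-involutive t) (Covers-mirror sv (mirror-sTree st) c))))

  meetIrreducible⇒joinIrreducible : ∀ {t} → IsSTree n s t → MeetIrreducible n s t → JoinIrreducible n s (mirror t)
  meetIrreducible⇒joinIrreducible {t} st (u , (su , cover) , unique) =
    mirror u , (mirror-sTree su , Covers-mirror su st cover) , λ v sv c →
      trans (sym (mirror-involutive v)) (cong mirror (unique (mirror v) (mirror-sTree sv)
        (subst (λ z → Covers n s (mirror v) z) (mirror-involutive t) (Covers-mirror (mirror-sTree st) sv c))))

  -- The arc (i, j, B, A, s_i + 1 − r), whose T_∨ is the mirror image of T_∧(α).
  dualArc : Arc n s → Arc n s
  dualArc α = record
    { i = i ; j = j ; 1≤i = 1≤i ; i<j = i<j ; j≤n = j≤n ; A = B ; B = A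
    ; disjoint = λ k (k∈B , k∈A) → disjoint k (k∈A , k∈B)
    ; cover→ = λ k k∈ → cover→ k (Sum.swap k∈)
    ; cover← = λ k k∈ → Sum.swap (cover← k k∈)
    ; r = suc (σ i) ∸ r
    ; 1≤r = subst (1 ≤_) (sym (+-∸-assoc 1 r≤s)) (s≤s z≤n)
    ; r≤s = ∸-monoʳ-≤ (suc (σ i)) 1≤r }
    where open Arc α

  dual-r-involutive : ∀ α → Arc.r (dualArc (dualArc α)) ≡ Arc.r α
  dual-r-involutive α = m∸[m∸n]≡n (≤-trans (Arc.r≤s α) (n≤1+n _))

  Tjoin-dualArc-dualArc : ∀ α → Tjoin (dualArc (dualArc α)) ≡ Tjoin α
  Tjoin-dualArc-dualArc α = cong (λ r → graft i r (rightComb σ I) (rightComb σ O)) (dual-r-involutive α)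
    where
    open Arc α
    I = labelsWhere n (λ k → lookup A k ∨ (suc (toℕ k) ≡ᵇ j))
    O = labelsWhere n (λ k → not (lookup A k ∨ (suc (toℕ k) ≡ᵇ j)))

  Tmeet≡mirror-Tjoin-dualArc : ∀ α → Tmeet α ≡ mirror (Tjoin (dualArc α))
  Tmeet≡mirror-Tjoin-dualArc α = sym (begin
    mirror (graft i r* (rightComb σ I) (rightComb σ O))         ≡⟨ mirror-graft σ i r* (rightComb σ I) (rightComb σ O) WF-O ⟩
    graft i (σ i ∸ r*) (mirror (rightComb σ I)) (mirror (rightComb σ O))
                                                                 ≡⟨ cong₂ (graft i (σ i ∸ r*)) (mirror-rightComb σ I) (mirror-rightComb σ O) ⟩
    graft i (σ i ∸ r*) (leftComb σ I) (leftComb σ O)             ≡⟨ cong (λ m → graft i m (leftComb σ I) (leftComb σ O)) σi∸r*≡r∸1 ⟩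
    graft i (r ∸ 1) (leftComb σ I) (leftComb σ O)                ∎)
    where
    open ≡-Reasoning
    open Arc α
    r* = suc (σ i) ∸ r
    I = labelsWhere n (λ k → lookup B k ∨ (suc (toℕ k) ≡ᵇ j))
    O = labelsWhere n (λ k → not (lookup B k ∨ (suc (toℕ k) ≡ᵇ j)))
    WF-O : WF σ (rightComb σ O)
    WF-O rewrite labelsWhere-filterBy n (λ k → not (lookup B k ∨ (suc (toℕ k) ≡ᵇ j))) (J∨.outer (dualArc α))
                                      (cong not ∘ inner-lookup (dualArc α))
      = Combs.WF-rightComb σ (J∨.O (dualArc α)) (J∨.O-ascending (dualArc α))
    σi∸r*≡r∸1 : σ i ∸ r* ≡ r ∸ 1
    σi∸r*≡r∸1 with r | 1≤r | r≤s
    ... | suc r′ | _ | r≤σi = m∸[m∸n]≡n (≤-trans (n≤1+n r′) r≤σi)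

  Tmeet-injective : ∀ α β → Tmeet α ≡ Tmeet β → SameArc α β
  Tmeet-injective α β e = undual (Tjoin-injective (dualArc α) (dualArc β)
    (mirror-injective (trans (sym (Tmeet≡mirror-Tjoin-dualArc α)) (trans e (Tmeet≡mirror-Tjoin-dualArc β)))))
    where
    undual : SameArc (dualArc α) (dualArc β) → SameArc α β
    undual (i≡ , j≡ , B≡ , A≡ , r*≡) =
      i≡ , j≡ , A≡ , B≡ ,
      trans (sym (dual-r-involutive α)) (trans (cong₂ (λ x y → suc (σ x) ∸ y) i≡ r*≡) (dual-r-involutive β))

  Tmeet-surjective : ∀ t → IsSTree n s t → MeetIrreducible n s t → ∃ λ α → Tmeet α ≡ t
  Tmeet-surjective t st mi =
    undual (Tjoin-surjective (mirror t) (mirror-sTree st) (meetIrreducible⇒joinIrreducible st mi))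
    where
    open ≡-Reasoning
    undual : (∃ λ β → Tjoin β ≡ mirror t) → ∃ λ α → Tmeet α ≡ t
    undual (β , e) = dualArc β , (begin
      Tmeet (dualArc β)                     ≡⟨ Tmeet≡mirror-Tjoin-dualArc (dualArc β) ⟩
      mirror (Tjoin (dualArc (dualArc β)))  ≡⟨ cong mirror (trans (Tjoin-dualArc-dualArc β) e) ⟩
      mirror (mirror t)                     ≡⟨ mirror-involutive t ⟩
      t                                     ∎)

  Tmeet-sTree : ∀ α → IsSTree n s (Tmeet α)
  Tmeet-sTree α = subst (IsSTree n s) (sym (Tmeet≡mirror-Tjoin-dualArc α)) (mirror-sTree (Tjoin-sTree (dualArc α)))

  Tmeet-meetIrreducible : ∀ α → MeetIrreducible n s (Tmeet α)
  Tmeet-meetIrreducible α = subst (MeetIrreducible n s) (sym (Tmeet≡mirror-Tjoin-dualArc α))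
    (joinIrreducible⇒meetIrreducible (Tjoin-sTree (dualArc α)) (Tjoin-joinIrreducible (dualArc α)))

proposition51 : (n : ℕ) → 1 ≤ n → (s : Vec ℕ n) →
    BijectionOnto n s Tjoin (JoinIrreducible n s) ×
    BijectionOnto n s Tmeet (MeetIrreducible n s)
proposition51 n _ s =
  ((λ α → Tjoin-sTree α , Tjoin-joinIrreducible α) , Tjoin-injective , Tjoin-surjective) ,
  ((λ α → Tmeet-sTree α , Tmeet-meetIrreducible α) , Tmeet-injective , Tmeet-surjective)
  where
  open JoinArcs n s
  open Meets n s
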